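{- Suppose $\Gamma\vdash t:X$ is derivable in $\textsc{core}$. Then the target program $\mathrm{Erase}(\mathrm{CpsDefun}(\Gamma\vdash t:X))$ has type $X^-\Gamma^+\to X^+\Gamma^-$ and lies in the equivalence class (i.e. defines the same morphism of $\mathbb{T}$) given by the Int-interpretation $[\![\Gamma\vdash t:X]\!]$ of the derivation.
   Context: Target language and $\mathbb{T}$: target types $A ::= \alpha\mid\mathtt{unit}\mid\mathtt{nat}\mid A\times B\mid A+B\mid\mu\alpha.A$ with standard expressions (including $<>$, pairs, $\mathtt{let}\ e\ \mathtt{be}\ <x,y>\ \mathtt{in}\ e'$, sums, case), standard typing and call-by-value evaluation to values. Over an infinite label set $\mathcal{L}$, a function definition is $f(x)=g(e)$ or $f(x)=\mathtt{case}\ e\ \mathtt{of}\ \mathtt{inl}(y)\Rightarrow g(e_1)\mid\mathtt{inr}(z)\Rightarrow h(e_2)$; a target program $(i,D,o)$ has a set $D$ of definitions (at most one per label, none for labels in $o$), a list $i$ of distinct entry labels and a list $o$ of distinct exit labels; $P\colon(A_1..A_n)\to(B_1..B_m)$ records the argument types of entry and exit labels. $f(v)\longrightarrow_P g(w)$ means running $f$'s definition on value $v$ jumps to $g$ with value $w$; call-traces are chains $f_1(v_1)\dots f_n(v_n)$ of such steps. Programs $P,Q$ of the same type with entries $f_i$/$g_i$ and exits $h_j$/$k_j$ are equal if for all $v,w,i,j$, $P$ has a trace $f_i(v)\dots h_j(w)$ iff $Q$ has a trace $g_i(v)\dots k_j(w)$. $\mathbb{T}$ has finite lists of target types as objects and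 equivalence classes of programs as morphisms. Syntactic sugar: $f()$ means $f(<>)$; $f(x,y)=\dots$ means a definition on a pair argument. Source $\textsc{core}$: types $X ::= 1\mid X\to Y$, terms $*\mid\lambda x{:}X.t\mid s\ t$, rules (ax) $x:X\vdash x:X$, (1i) $\vdash *:1$, (weak), (exch), ($\to$i), ($\to$e) (the linear $\lambda$-calculus; in ($\to$e) the conclusion context is $\Gamma,\Delta$ for $\Gamma\vdash s$, $\Delta\vdash t$). Interfaces: $1^-=1^+=\mathtt{unit}$, $(X\to Y)^-=Y^-X^+$, $(X\to Y)^+=Y^+X^-$ (list concatenation); for $\Gamma=x_1:X_1,\dots,x_n:X_n$, $\Gamma^-=X_n^-\dots X_1^-$ and $\Gamma^+=X_n^+\dots X_1^+$. Int-interpretation: a derivation of $\Gamma\vdash t:X$ is interpreted as a morphism $[\![\Gamma\vdash t:X]\!]\colon X^-\Gamma^+\to X^+\Gamma^-$ of $\mathbb{T}$, by induction: (ax) for $x:X\vdash x:X$ the program $X^-X^+\to X^+X^-$ that forwards each input port of the $X^-$ block unchanged to the corresponding output port of the $X^-$ block and each input port of the $X^+$ block to the corresponding output port of the $X^+$ block (definitions $f(z)=g(z)$); (1i) the program $(f,\{f(z)=g(<>)\},g)\colon\mathtt{unit}\to\mathtt{unit}$; (weak) add fresh entry labels (without definitions) for the new $X^+$ block and fresh exit labels for the new $X^-$ block; (exch) permute the corresponding blocks of entry and exit labels; ($\to$i) the same program, since $Y^-X^+\Gamma^+=(X\to Y)^-\Gamma^+$ and $Y^+X^-\Gamma^-=(X\to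 Y)^+\Gamma^-$; ($\to$e) given $P\colon Y^-X^+\Gamma^+\to Y^+X^-\Gamma^-$ for $s$ and $Q\colon X^-\Delta^+\to X^+\Delta^-$ for $t$, rename labels so that $P$'s exit labels of the $X^-$ block equal $Q$'s entry labels of the $X^-$ block, $Q$'s exit labels of the $X^+$ block equal $P$'s entry labels of the $X^+$ block, and all other labels are disjoint; the result is the program with entry labels ($P$'s $Y^-$ block)($Q$'s $\Delta^+$ block)($P$'s $\Gamma^+$ block), exit labels ($P$'s $Y^+$ block)($Q$'s $\Delta^-$ block)($P$'s $\Gamma^-$ block), and definitions $D_P\cup D_Q$ (the trace/feedback of $\mathbb{T}$), of type $Y^-(\Gamma,\Delta)^+\to Y^+(\Gamma,\Delta)^-$. CPS-translation: with $\bot$, products and $\neg X=X\to\bot$ added, $\underline 1=\neg 1$, $\underline{X\to Y}=\neg\underline X\times\underline Y$, $\overline X=\neg\underline X$; $\eta(t,X)=t$ for $X\in\{1,\bot\}$, $\eta(t,X_1\times X_2)=\mathtt{let}\ t\ \mathtt{be}\ <x,y>\ \mathtt{in}\ <\eta(x,X_1),\eta(y,X_2)>$, $\eta(t,X_1\to X_2)=\lambda x.\eta(t\ \eta(x,X_1),X_2)$. Rules: (ax) $\eta(x,\overline X)$; (1i) $\lambda k.k\ *$; (weak),(exch) unchanged term; ($\to$i) $\lambda<x,k>.\underline t\ k$ where $\lambda<x,k>.u$ means $\lambda z.\mathtt{let}\ z\ \mathtt{be}\ <x,k>\ \mathtt{in}\ u$; ($\to$e) $\lambda k.\underline s\ <\underline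 t,k>$. Labelling: abstractions $\lambda^l x.t$ (labels unique per abstraction), applications $s\ @^l\ t$, types $X\xrightarrow{l}Y$, $\neg_lX=X\xrightarrow{l}\bot$; typing requires an application $s\ @^l\ t$ to have $s:X\xrightarrow{l}Y$. For label lists of the right lengths, $\overline1[q,a]=\neg_q\neg_a1$ and, if $\overline Y[y^-,y^+]=\neg_qY'$, $\overline{X\to Y}[y^-x^+,y^+x^-]=\neg_q(\overline X[x^-,x^+]\times Y')$; $\overline\Gamma[x_n^-..x_1^-,x_n^+..x_1^+]$ is $x_1:\overline{X_1}[x_1^-,x_1^+],\dots$. Every CPS-translated $\textsc{core}$ derivation can be labelled to derive a sequent $\overline\Gamma[\gamma^-,\gamma^+]\vdash\underline t:\overline X[x^-,x^+]$ with all labels in $\gamma^\pm,x^\pm$ pairwise distinct. Defunctionalization of a labelled term: expression $t^*$ and definition set $D(t)$: $x^*=x$, $D(x)=\emptyset$; $*^*=<>$, $D(*)=\emptyset$; $<s,t>^*=<s^*,t^*>$, $D=D(s)\cup D(t)$; $(\mathtt{let}\ t\ \mathtt{be}\ <x,y>\ \mathtt{in}\ s)^*=\mathtt{let}\ t^*\ \mathtt{be}\ <x,y>\ \mathtt{in}\ s^*$, $D=D(t)\cup D(s)$; $(s\ @^l\ t)^*=\mathit{apply}_l(s^*,t^*)$, $D=D(s)\cup D(t)$; $(\lambda^l x.t)^*=<x_1,\dots,x_n>$ where $x_1,\dots,x_n$ are the free variables of $\lambda^l x.t$ in a fixed global order, and $D(\lambda^l x.t)=D(t)\cup\{\mathit{apply}_l(<x_1,\dots,x_n>,x)=t^*\}$.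 Here $\mathit{apply}_l$ is a function label of the target language taking the pair of its two arguments. $\mathrm{CpsDefun}(\Gamma\vdash t:X)$ is the target program $(x^-\gamma^+,D(\underline t),x^+\gamma^-)$ for such a labelling (a label $l$ in the entry/exit lists denoting $\mathit{apply}_l$); it is independent of the choice of labels up to renaming. $\mathrm{Erase}(i,E,o)=(i,\{f(z)=g(<>)\mid f(x)=g(e)\in E\},o)$, i.e. all function arguments are replaced by $<>$ (definitions by case distinction are dropped; none occur here). -}

module Defs where

open import Data.Nat using (ℕ; zero; suc; _+_; _∸_; _≡ᵇ_; _<ᵇ_; _≤ᵇ_)
open import Data.Bool using (Bool; true; false; if_then_else_; _∧_; _∨_; not)
open import Data.List using (List; []; _∷_; _++_; [_]; map; length; concatMap; splitAt; drop; upTo; mapMaybe; filter; foldr)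
open import Data.Maybe using (Maybe; just; nothing; _>>=_)
open import Data.Product using (Σ; _×_; _,_; proj₁; proj₂)
open import Data.List.Relation.Unary.All using (All)
open import Data.List.Relation.Unary.Unique.Propositional using (Unique)
open import Data.List.Membership.Propositional using (_∈_; _∉_)
open import Data.List.Relation.Binary.Disjoint.Propositional using (Disjoint)
open import Relation.Binary.PropositionalEquality using (_≡_)
open import Relation.Binary.Construct.Closure.ReflexiveTransitive using (Star)

-- An address of a node in a derivation tree (used to generate fresh names).
Addr : Set
Addr = List ℕ

-- Function labels (the infinite label set 𝓛).
--   top n   : labels of the top-level interface (entry/exit labels)
--   loc p n : the n-th internal (fresh) label generated at address p
data Label : Set where
  top : ℕ → Label
  loc : Addr → ℕ → Label

-- Variables of the target language / of CPS terms.
--   src n   : a variable of the source term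
--   gen p n : the n-th fresh variable generated at address p
--   aux n   : auxiliary variables used for unpacking function arguments
data Var : Set where
  src : ℕ → Var
  gen : Addr → ℕ → Var
  aux : ℕ → Var

eqList : List ℕ → List ℕ → Bool
eqList [] [] = true
eqList (a ∷ as) (b ∷ bs) = (a ≡ᵇ b) ∧ eqList as bs
eqList _ _ = false

leqList : List ℕ → List ℕ → Bool
leqList [] _ = true
leqList (a ∷ as) [] = false
leqList (a ∷ as) (b ∷ bs) = (a <ᵇ b) ∨ ((a ≡ᵇ b) ∧ leqList as bs)

_==ᵥ_ : Var → Var → Bool
src a ==ᵥ src b = a ≡ᵇ b
gen p a ==ᵥ gen q b = eqList p q ∧ (a ≡ᵇ b)
aux a ==ᵥ aux b = a ≡ᵇ b
_ ==ᵥ _ = false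

_≤ᵥ_ : Var → Var → Bool
src a ≤ᵥ src b = a ≤ᵇ b
src _ ≤ᵥ _ = true
gen _ _ ≤ᵥ src _ = false
gen p a ≤ᵥ gen q b = (leqList p q ∧ not (eqList p q)) ∨ (eqList p q ∧ (a ≤ᵇ b))
gen _ _ ≤ᵥ aux _ = true
aux _ ≤ᵥ src _ = false
aux _ ≤ᵥ gen _ _ = false
aux a ≤ᵥ aux b = a ≤ᵇ b

-- Target language

-- target types A ::= α | unit | nat | A × B | A + B | μα.A  (de Bruijn)
data TTy : Set where
  tvar : ℕ → TTy
  unit : TTy
  nat  : TTy
  _⊗_  : TTy → TTy → TTy
  _⊕_  : TTy → TTy → TTy
  mu   : TTy → TTy

shiftT : ℕ → TTy → TTy
shiftT c (tvar n) = if n <ᵇ c then tvar n else tvar (suc n)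
shiftT c unit = unit
shiftT c nat = nat
shiftT c (A ⊗ B) = shiftT c A ⊗ shiftT c B
shiftT c (A ⊕ B) = shiftT c A ⊕ shiftT c B
shiftT c (mu A) = mu (shiftT (suc c) A)

substT : ℕ → TTy → TTy → TTy
substT j s (tvar n) = if n ≡ᵇ j then s else (if j <ᵇ n then tvar (n ∸ 1) else tvar n)
substT j s unit = unit
substT j s nat = nat
substT j s (A ⊗ B) = substT j s A ⊗ substT j s B
substT j s (A ⊕ B) = substT j s A ⊕ substT j s B
substT j s (mu A) = mu (substT (suc j) (shiftT 0 s) A)

unrollT : TTy → TTy
unrollT A = substT 0 (mu A) A

data Exp : Set where
  var    : Var → Exp
  unitE  : Exp
  zeroE  : Exp
  succE  : Exp → Exp
  pairE  : Exp → Exp → Exp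
  letP   : Exp → Var → Var → Exp → Exp
  inlE   : Exp → Exp
  inrE   : Exp → Exp
  caseE  : Exp → Var → Exp → Var → Exp → Exp
  foldE  : Exp → Exp
  unfoldE : Exp → Exp

data Val : Set where
  vunit : Val
  vnat  : ℕ → Val
  vpair : Val → Val → Val
  vinl  : Val → Val
  vinr  : Val → Val
  vfold : Val → Val

lookupV : {A : Set} → List (Var × A) → Var → Maybe A
lookupV [] x = nothing
lookupV ((y , a) ∷ ρ) x = if x ==ᵥ y then just a else lookupV ρ x

TCtx : Set
TCtx = List (Var × TTy)

infix 4 _⊢ₑ_∶_
data _⊢ₑ_∶_ : TCtx → Exp → TTy → Set where
  t-var   : ∀ {Δ x A} → lookupV Δ x ≡ just A → Δ ⊢ₑ var x ∶ A
  t-unit  : ∀ {Δ} → Δ ⊢ₑ unitE ∶ unit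
  t-zero  : ∀ {Δ} → Δ ⊢ₑ zeroE ∶ nat
  t-succ  : ∀ {Δ e} → Δ ⊢ₑ e ∶ nat → Δ ⊢ₑ succE e ∶ nat
  t-pair  : ∀ {Δ e e' A B} → Δ ⊢ₑ e ∶ A → Δ ⊢ₑ e' ∶ B → Δ ⊢ₑ pairE e e' ∶ A ⊗ B
  t-let   : ∀ {Δ e x y e' A B C} → Δ ⊢ₑ e ∶ A ⊗ B →
            ((y , B) ∷ (x , A) ∷ Δ) ⊢ₑ e' ∶ C → Δ ⊢ₑ letP e x y e' ∶ C
  t-inl   : ∀ {Δ e A B} → Δ ⊢ₑ e ∶ A → Δ ⊢ₑ inlE e ∶ A ⊕ B
  t-inr   : ∀ {Δ e A B} → Δ ⊢ₑ e ∶ B → Δ ⊢ₑ inrE e ∶ A ⊕ B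
  t-case  : ∀ {Δ e x e1 y e2 A B C} → Δ ⊢ₑ e ∶ A ⊕ B →
            ((x , A) ∷ Δ) ⊢ₑ e1 ∶ C → ((y , B) ∷ Δ) ⊢ₑ e2 ∶ C →
            Δ ⊢ₑ caseE e x e1 y e2 ∶ C
  t-fold  : ∀ {Δ e A} → Δ ⊢ₑ e ∶ unrollT A → Δ ⊢ₑ foldE e ∶ mu A
  t-unfold : ∀ {Δ e A} → Δ ⊢ₑ e ∶ mu A → Δ ⊢ₑ unfoldE e ∶ unrollT A

infix 4 ⊢ᵥ_∶_
data ⊢ᵥ_∶_ : Val → TTy → Set where
  v-unit : ⊢ᵥ vunit ∶ unit
  v-nat  : ∀ {n} → ⊢ᵥ vnat n ∶ nat
  v-pair : ∀ {v w A B} → ⊢ᵥ v ∶ A → ⊢ᵥ w ∶ B → ⊢ᵥ vpair v w ∶ A ⊗ B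
  v-inl  : ∀ {v A B} → ⊢ᵥ v ∶ A → ⊢ᵥ vinl v ∶ A ⊕ B
  v-inr  : ∀ {v A B} → ⊢ᵥ v ∶ B → ⊢ᵥ vinr v ∶ A ⊕ B
  v-fold : ∀ {v A} → ⊢ᵥ v ∶ unrollT A → ⊢ᵥ vfold v ∶ mu A

Env : Set
Env = List (Var × Val)

infix 4 _⊢_⇓_
data _⊢_⇓_ : Env → Exp → Val → Set where
  e-var   : ∀ {ρ x v} → lookupV ρ x ≡ just v → ρ ⊢ var x ⇓ v
  e-unit  : ∀ {ρ} → ρ ⊢ unitE ⇓ vunit
  e-zero  : ∀ {ρ} → ρ ⊢ zeroE ⇓ vnat zero
  e-succ  : ∀ {ρ e n} → ρ ⊢ e ⇓ vnat n → ρ ⊢ succE e ⇓ vnat (suc n)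
  e-pair  : ∀ {ρ e e' v w} → ρ ⊢ e ⇓ v → ρ ⊢ e' ⇓ w → ρ ⊢ pairE e e' ⇓ vpair v w
  e-let   : ∀ {ρ e x y e' v w u} → ρ ⊢ e ⇓ vpair v w →
            ((y , w) ∷ (x , v) ∷ ρ) ⊢ e' ⇓ u → ρ ⊢ letP e x y e' ⇓ u
  e-inl   : ∀ {ρ e v} → ρ ⊢ e ⇓ v → ρ ⊢ inlE e ⇓ vinl v
  e-inr   : ∀ {ρ e v} → ρ ⊢ e ⇓ v → ρ ⊢ inrE e ⇓ vinr v
  e-casel : ∀ {ρ e x e1 y e2 v u} → ρ ⊢ e ⇓ vinl v → ((x , v) ∷ ρ) ⊢ e1 ⇓ u →
            ρ ⊢ caseE e x e1 y e2 ⇓ u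
  e-caser : ∀ {ρ e x e1 y e2 v u} → ρ ⊢ e ⇓ vinr v → ((y , v) ∷ ρ) ⊢ e2 ⇓ u →
            ρ ⊢ caseE e x e1 y e2 ⇓ u
  e-fold  : ∀ {ρ e v} → ρ ⊢ e ⇓ v → ρ ⊢ foldE e ⇓ vfold v
  e-unfold : ∀ {ρ e v} → ρ ⊢ e ⇓ vfold v → ρ ⊢ unfoldE e ⇓ v

-- Target programs

-- f(x) = g(e)   |   f(x) = case e of inl(y) ⇒ g(e1) | inr(z) ⇒ h(e2)
data Def : Set where
  jump   : Label → Var → Label → Exp → Def
  branch : Label → Var → Exp → Var → Label → Exp → Var → Label → Exp → Def

defLabel : Def → Label
defLabel (jump f _ _ _) = f
defLabel (branch f _ _ _ _ _ _ _ _) = f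

record Prog : Set where
  constructor prog
  field
    ins  : List Label
    defs : List Def
    outs : List Label
open Prog public

WellFormed : Prog → Set
WellFormed P = Unique (ins P) × Unique (outs P) × Unique (map defLabel (defs P))
             × All (λ d → defLabel d ∉ outs P) (defs P)

DefOK : (Label → TTy) → Def → Set
DefOK τ (jump f x g e) = ((x , τ f) ∷ []) ⊢ₑ e ∶ τ g
DefOK τ (branch f x e y g e1 z h e2) = Σ TTy λ A → Σ TTy λ B →
  (((x , τ f) ∷ []) ⊢ₑ e ∶ A ⊕ B) ×
  (((y , A) ∷ (x , τ f) ∷ []) ⊢ₑ e1 ∶ τ g) ×
  (((z , B) ∷ (x , τ f) ∷ []) ⊢ₑ e2 ∶ τ h)

_∶_⟶_ : Prog → List TTy → List TTy → Set
P ∶ As ⟶ Bs = WellFormed P × (Σ (Label → TTy) λ τ →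
  (map τ (ins P) ≡ As) × (map τ (outs P) ≡ Bs) × All (DefOK τ) (defs P))

data Step (P : Prog) : Label × Val → Label × Val → Set where
  s-jump : ∀ {f x g e v w} → jump f x g e ∈ defs P → ((x , v) ∷ []) ⊢ e ⇓ w →
           Step P (f , v) (g , w)
  s-inl  : ∀ {f x e y g e1 z h e2 v u w} → branch f x e y g e1 z h e2 ∈ defs P →
           ((x , v) ∷ []) ⊢ e ⇓ vinl u → ((y , u) ∷ (x , v) ∷ []) ⊢ e1 ⇓ w →
           Step P (f , v) (g , w)
  s-inr  : ∀ {f x e y g e1 z h e2 v u w} → branch f x e y g e1 z h e2 ∈ defs P →
           ((x , v) ∷ []) ⊢ e ⇓ vinr u → ((z , u) ∷ (x , v) ∷ []) ⊢ e2 ⇓ w →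
           Step P (f , v) (h , w)

Trace : Prog → Label × Val → Label × Val → Set
Trace P = Star (Step P)

nth : {A : Set} → List A → ℕ → Maybe A
nth [] _ = nothing
nth (a ∷ as) zero = just a
nth (a ∷ as) (suc n) = nth as n

-- equality of programs of type As → Bs (the morphisms of 𝕋)
ProgEq : List TTy → List TTy → Prog → Prog → Set
ProgEq As Bs P Q = ∀ (i j : ℕ) (f g h k : Label) (A B : TTy) (v w : Val) →
  nth (ins P) i ≡ just f → nth (ins Q) i ≡ just g →
  nth (outs P) j ≡ just h → nth (outs Q) j ≡ just k →
  nth As i ≡ just A → nth Bs j ≡ just B → ⊢ᵥ v ∶ A → ⊢ᵥ w ∶ B →
  (Trace P (f , v) (h , w) → Trace Q (g , v) (k , w)) ×
  (Trace Q (g , v) (k , w) → Trace P (f , v) (h , w))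

-- Source language CORE (linear λ-calculus)

infixr 5 _⇒_
data Ty : Set where
  one : Ty
  _⇒_ : Ty → Ty → Ty

data Term : Set where
  var  : ℕ → Term
  star : Term
  lam  : ℕ → Ty → Term → Term
  app  : Term → Term → Term

-- contexts are stored REVERSED: the head of the list is the rightmost
-- variable, i.e. (x , X) ∷ Γ represents  Γ, x:X
Ctx : Set
Ctx = List (ℕ × Ty)

names : Ctx → List ℕ
names = map proj₁

infix 3 _⊢_∶_
data _⊢_∶_ : Ctx → Term → Ty → Set where
  ax   : ∀ {x X} → ((x , X) ∷ []) ⊢ var x ∶ X
  oneI : [] ⊢ star ∶ one
  weak : ∀ {Γ t Y x X} → x ∉ names Γ → Γ ⊢ t ∶ Y → ((x , X) ∷ Γ) ⊢ t ∶ Y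
  exch : ∀ {Δ a b Γ t Y} → (Δ ++ a ∷ b ∷ Γ) ⊢ t ∶ Y → (Δ ++ b ∷ a ∷ Γ) ⊢ t ∶ Y
  lamI : ∀ {Γ x X t Y} → x ∉ names Γ → ((x , X) ∷ Γ) ⊢ t ∶ Y → Γ ⊢ lam x X t ∶ X ⇒ Y
  appE : ∀ {Γ Δ s t X Y} → Disjoint (names Γ) (names Δ) →
         Γ ⊢ s ∶ X ⇒ Y → Δ ⊢ t ∶ X → (Δ ++ Γ) ⊢ app s t ∶ Y
         -- (Δ ++ Γ) represents Γ, Δ

minus : Ty → List TTy
plus  : Ty → List TTy
minus one = unit ∷ []
minus (X ⇒ Y) = minus Y ++ plus X
plus one = unit ∷ []
plus (X ⇒ Y) = plus Y ++ minus X

-- Γ⁻ = Xₙ⁻ … X₁⁻ and Γ⁺ = Xₙ⁺ … X₁⁺ (Ctx is stored reversed)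
minusC : Ctx → List TTy
minusC = concatMap (λ p → minus (proj₂ p))
plusC : Ctx → List TTy
plusC = concatMap (λ p → plus (proj₂ p))

#⁻ : Ty → ℕ
#⁻ X = length (minus X)
#⁺ : Ty → ℕ
#⁺ X = length (plus X)

hd : List Label → Label
hd [] = top 0
hd (l ∷ _) = l

tl : List Label → List Label
tl [] = []
tl (_ ∷ ls) = ls

fresh : Addr → ℕ → ℕ → List Label
fresh p s n = map (λ i → loc p (s + i)) (upTo n)

tops : ℕ → ℕ → List Label
tops s n = map (λ i → top (s + i)) (upTo n)

-- labels of a context: for each variable, (labels of its X⁻ block, labels of its X⁺ block)
CLabs : Set
CLabs = List (List Label × List Label)

swapAt : {A : Set} → ℕ → List A → List A
swapAt zero (a ∷ b ∷ r) = b ∷ a ∷ r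
swapAt (suc n) (a ∷ r) = a ∷ swapAt n r
swapAt _ r = r

headC : CLabs → List Label × List Label
headC [] = [] , []
headC (c ∷ _) = c

-- Int-interpretation  [[Γ ⊢ t : X]] : X⁻ Γ⁺ → X⁺ Γ⁻
-- intD d p xm xp cl : the definitions of the program, where
--   xm = labels of the X⁻ block (entries), xp = labels of the X⁺ block (exits),
--   cl = labels of the context blocks (X⁻ block = exits, X⁺ block = entries);
-- the "renaming of labels" in (→e) is realised by passing label lists,
-- internal labels are generated fresh from the address p.

fwdV : Var
fwdV = aux 0

fwds : List Label → List Label → List Def
fwds (f ∷ fs) (g ∷ gs) = jump f fwdV g (var fwdV) ∷ fwds fs gs
fwds _ _ = []

intD : ∀ {Γ t X} → Γ ⊢ t ∶ X → Addr → List Label → List Label → CLabs → List Def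
intD ax p xm xp cl = fwds xm (proj₁ (headC cl)) ++ fwds (proj₂ (headC cl)) xp
intD oneI p xm xp cl = jump (hd xm) fwdV (hd xp) unitE ∷ []
intD (weak _ d) p xm xp cl = intD d (0 ∷ p) xm xp (drop 1 cl)
intD (exch {Δ = Δ} d) p xm xp cl = intD d (0 ∷ p) xm xp (swapAt (length Δ) cl)
intD (lamI {X = X} {Y = Y} _ d) p xm xp cl =
  intD d (0 ∷ p) (proj₁ (splitAt (#⁻ Y) xm)) (proj₁ (splitAt (#⁺ Y) xp))
       ((proj₂ (splitAt (#⁺ Y) xp) , proj₂ (splitAt (#⁻ Y) xm)) ∷ cl)
intD (appE {Δ = Δ} {X = X} _ ds dt) p ym yp cl =
  intD ds (0 ∷ p) (ym ++ lp) (yp ++ lm) (proj₂ (splitAt (length Δ) cl)) ++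
  intD dt (1 ∷ p) lm lp (proj₁ (splitAt (length Δ) cl))
  where
  lm = fresh p 0 (#⁻ X)
  lp = fresh p (#⁻ X) (#⁺ X)

ctxLabs : ℕ → Ctx → CLabs
ctxLabs n [] = []
ctxLabs n ((_ , X) ∷ Γ) = (tops n (#⁻ X) , tops (n + #⁻ X) (#⁺ X)) ∷ ctxLabs (n + #⁻ X + #⁺ X) Γ

topXm : Ty → List Label
topXm X = tops 0 (#⁻ X)
topXp : Ty → List Label
topXp X = tops (#⁻ X) (#⁺ X)
topCl : Ty → Ctx → CLabs
topCl X Γ = ctxLabs (#⁻ X + #⁺ X) Γ

entriesOf : Ty → Ctx → List Label
entriesOf X Γ = topXm X ++ concatMap proj₂ (topCl X Γ)
exitsOf : Ty → Ctx → List Label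
exitsOf X Γ = topXp X ++ concatMap proj₁ (topCl X Γ)

Int⟦_⟧ : ∀ {Γ t X} → Γ ⊢ t ∶ X → Prog
Int⟦_⟧ {Γ} {X = X} d = prog (entriesOf X Γ) (intD d [] (topXm X) (topXp X) (topCl X Γ)) (exitsOf X Γ)

-- Labelled CPS terms and types

data LTy : Set where
  one' : LTy
  bot  : LTy
  prod : LTy → LTy → LTy
  arr  : Label → LTy → LTy → LTy

neg : Label → LTy → LTy
neg l A = arr l A bot

data LTerm : Set where
  lvar  : Var → LTerm
  lstar : LTerm
  lpair : LTerm → LTerm → LTerm
  llet  : LTerm → Var → Var → LTerm → LTerm
  lapp  : Label → LTerm → LTerm → LTerm
  llam  : Label → Var → LTerm → LTerm

-- X̄[x⁻, x⁺] = ¬_{head x⁻} X̲[tail x⁻, x⁺]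
-- X̲[1][ [], [a] ] = ¬ₐ 1 ;  (X→Y)̲[ tail(y⁻) x⁺ , y⁺ x⁻ ] = X̄[x⁻,x⁺] × Y̲[tail y⁻, y⁺]
ul : Ty → List Label → List Label → LTy
ol : Ty → List Label → List Label → LTy
ul one m p = neg (hd p) one'
ul (X ⇒ Y) m p =
  prod (ol X (proj₂ (splitAt (#⁺ Y) p)) (proj₂ (splitAt (#⁻ Y ∸ 1) m)))
       (ul Y (proj₁ (splitAt (#⁻ Y ∸ 1) m)) (proj₁ (splitAt (#⁺ Y) p)))
ol X m p = neg (hd m) (ul X (tl m) p)

-- η-expansion η(t, ·) from a labelled type (that of t) to a labelled type
-- of the same shape; fresh variables generated from the address q
eta : Addr → LTerm → LTy → LTy → LTerm
eta q t (prod s1 s2) (prod t1 t2) =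
  llet t (gen q 0) (gen q 1)
       (lpair (eta (0 ∷ q) (lvar (gen q 0)) s1 t1) (eta (1 ∷ q) (lvar (gen q 1)) s2 t2))
eta q t (arr l1 s1 s2) (arr l2 t1 t2) =
  llam l2 (gen q 0) (eta (1 ∷ q) (lapp l1 t (eta (0 ∷ q) (lvar (gen q 0)) t1 s1)) s2 t2)
eta q t _ _ = t

-- CPS translation with the canonical labelling:
-- cps d p xm xp cl derives  Γ̄[cl] ⊢ t̲ : X̄[xm, xp]
cps : ∀ {Γ t X} → Γ ⊢ t ∶ X → Addr → List Label → List Label → CLabs → LTerm
cps (ax {x = x} {X = X}) p xm xp cl =
  eta p (lvar (src x)) (ol X (proj₁ (headC cl)) (proj₂ (headC cl))) (ol X xm xp)
cps oneI p xm xp cl = llam (hd xm) (gen p 0) (lapp (hd xp) (lvar (gen p 0)) lstar)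
cps (weak _ d) p xm xp cl = cps d (0 ∷ p) xm xp (drop 1 cl)
cps (exch {Δ = Δ} d) p xm xp cl = cps d (0 ∷ p) xm xp (swapAt (length Δ) cl)
cps (lamI {x = x} {X = X} {Y = Y} _ d) p xm xp cl =
  llam (hd xm) (gen p 0)
    (llet (lvar (gen p 0)) (src x) (gen p 1)
      (lapp q' (cps d (0 ∷ p) (q' ∷ proj₁ (splitAt (#⁻ Y ∸ 1) (tl xm))) (proj₁ (splitAt (#⁺ Y) xp))
                  ((proj₂ (splitAt (#⁺ Y) xp) , proj₂ (splitAt (#⁻ Y ∸ 1) (tl xm))) ∷ cl))
               (lvar (gen p 1))))
  where
  q' = loc p 0
cps (appE {Δ = Δ} {X = X} _ ds dt) p ym yp cl =
  llam (hd ym) (gen p 0)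
    (lapp q' (cps ds (0 ∷ p) (q' ∷ (tl ym ++ lp)) (yp ++ lm) (proj₂ (splitAt (length Δ) cl)))
             (lpair (cps dt (1 ∷ p) lm lp (proj₁ (splitAt (length Δ) cl))) (lvar (gen p 0))))
  where
  q' = loc p 0
  lm = fresh p 1 (#⁻ X)
  lp = fresh p (1 + #⁻ X) (#⁺ X)

-- Defunctionalization

removeV : Var → List Var → List Var
removeV x [] = []
removeV x (y ∷ ys) = if y ==ᵥ x then removeV x ys else y ∷ removeV x ys

dedupV : List Var → List Var
dedupV [] = []
dedupV (x ∷ xs) = x ∷ removeV x (dedupV xs)

insertV : Var → List Var → List Var
insertV x [] = x ∷ []
insertV x (y ∷ ys) = if x ≤ᵥ y then x ∷ y ∷ ys else y ∷ insertV x ys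

sortV : List Var → List Var
sortV = foldr insertV []

fvRaw : LTerm → List Var
fvRaw (lvar x) = x ∷ []
fvRaw lstar = []
fvRaw (lpair a b) = fvRaw a ++ fvRaw b
fvRaw (llet e x y u) = fvRaw e ++ removeV x (removeV y (fvRaw u))
fvRaw (lapp l a b) = fvRaw a ++ fvRaw b
fvRaw (llam l x u) = removeV x (fvRaw u)

fv : LTerm → List Var
fv t = sortV (dedupV (fvRaw t))

-- target expressions extended with  apply_l(e, e')
data DExp : Set where
  dvar  : Var → DExp
  dunit : DExp
  dpair : DExp → DExp → DExp
  dlet  : DExp → Var → Var → DExp → DExp
  dapp  : Label → DExp → DExp → DExp

tuple : List Var → DExp
tuple [] = dunit
tuple (x ∷ xs) = dpair (dvar x) (tuple xs)

-- apply_l(<x₁..xₙ>, x) = body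
record DDef : Set where
  constructor ddef
  field
    dlabel : Label
    denv   : List Var
    dparam : Var
    dbody  : DExp

defun : LTerm → DExp × List DDef
defun (lvar x) = dvar x , []
defun lstar = dunit , []
defun (lpair a b) = dpair (proj₁ (defun a)) (proj₁ (defun b)) , proj₂ (defun a) ++ proj₂ (defun b)
defun (llet e x y u) = dlet (proj₁ (defun e)) x y (proj₁ (defun u)) , proj₂ (defun e) ++ proj₂ (defun u)
defun (lapp l a b) = dapp l (proj₁ (defun a)) (proj₁ (defun b)) , proj₂ (defun a) ++ proj₂ (defun b)
defun (llam l x u) = tuple (fv (llam l x u)) , proj₂ (defun u) ++ (ddef l (fv (llam l x u)) x (proj₁ (defun u)) ∷ [])

pureE : DExp → Maybe Exp
pureE (dvar x) = just (var x)
pureE dunit = just unitE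
pureE (dpair a b) = pureE a >>= λ a' → pureE b >>= λ b' → just (pairE a' b')
pureE (dlet e x y u) = pureE e >>= λ e' → pureE u >>= λ u' → just (letP e' x y u')
pureE (dapp _ _ _) = nothing

-- a tail call  let … in apply_g(a, b)  as the jump  g(let … in <a, b>)
tailE : DExp → Maybe (Label × Exp)
tailE (dapp g a b) = pureE a >>= λ a' → pureE b >>= λ b' → just (g , pairE a' b')
tailE (dlet e x y u) = pureE e >>= λ e' → tailE u >>= λ r → just (proj₁ r , letP e' x y (proj₂ r))
tailE _ = nothing

-- let rₙ be <x, rₙ₊₁> in …  (unpacking the closure environment)
unpack : ℕ → List Var → Exp → Exp
unpack n [] e = e
unpack n (x ∷ xs) e = letP (var (aux n)) x (aux (suc n)) (unpack (suc n) xs e)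

-- apply_l(<x₁..xₙ>, x) = t*   as   apply_l(z) = g(let z be <r₁, x> in let r₁ be <x₁, r₂> in … e)
toDef : DDef → Maybe Def
toDef (ddef l xs x body) =
  tailE body >>= λ r → just (jump l (aux 0) (proj₁ r) (letP (var (aux 0)) (aux 1) x (unpack 1 xs (proj₂ r))))

mapM : {A B : Set} → (A → Maybe B) → List A → Maybe (List B)
mapM f [] = just []
mapM f (a ∷ as) = f a >>= λ b → mapM f as >>= λ bs → just (b ∷ bs)

CpsDefun : ∀ {Γ t X} → Γ ⊢ t ∶ X → Maybe Prog
CpsDefun {Γ} {X = X} d =
  mapM toDef (proj₂ (defun (cps d [] (topXm X) (topXp X) (topCl X Γ)))) >>= λ ds →
  just (prog (entriesOf X Γ) ds (exitsOf X Γ))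

eraseDef : Def → Maybe Def
eraseDef (jump f x g e) = just (jump f x g unitE)
eraseDef (branch _ _ _ _ _ _ _ _ _) = nothing

Erase : Prog → Prog
Erase P = prog (ins P) (mapMaybe eraseDef (defs P)) (outs P)

-- Both programs only ever pass the value <>, so their call-traces are exactly
-- the paths along their jumps, and the proof compares two graphs on labels.
-- Defunctionalisation succeeds on CPS-shaped terms and, after erasure, leaves
-- one jump per λ-abstraction (pure-defun).  An η-expanded variable jumps, up to
-- order, exactly like the forwarding of the (ax) rule (ol-etaEdges).  At each
-- node of the derivation the CPS labels are the Int labels shifted by φ, and
-- every jump of either program is realised by a path of the other (cps⇒int,
-- int⇒cps).  Counting occurrences of labels shows that the CPS program defines
-- each label at most once and no exit label (sources-bound).  At the root φ
-- fixes all interface labels, which yields the theorem (module Root).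
module Submission where

open import Defs
open import Data.Nat as ℕ using (ℕ; zero; suc; _+_; _∸_; _≤_; z≤n; s≤s)
open import Data.Nat.Properties
open import Data.Empty using (⊥; ⊥-elim)
open import Data.Unit using (⊤; tt)
open import Data.Maybe using (Maybe; just; _>>=_)
open import Data.Maybe.Properties using (just-injective)
open import Data.List using (List; []; _∷_; _++_; [_]; map; mapMaybe; splitAt; length; zip; filter; upTo; applyUpTo; concatMap)
open import Data.List.Properties
  using (map-++; mapMaybe-++; ++-assoc; ++-identityʳ; map-cong; map-∘; map-applyUpTo; map-upTo; concatMap-++;
         length-map; length-upTo; length-++; zip-map; filter-++; splitAt-defn; splitAt-map; take++drop≡id; ≡-dec)
open import Data.List.Membership.Propositional using (_∈_; _∉_)
open import Data.List.Membership.Propositional.Properties using (∈-++⁺ˡ; ∈-++⁺ʳ; ∈-map⁺; ∈-map⁻)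
open import Data.List.Relation.Unary.Any using (here; there)
open import Data.List.Relation.Unary.All as All using (All; []; _∷_)
import Data.List.Relation.Unary.All.Properties as All
open import Data.List.Relation.Unary.All.Properties using () renaming (++⁺ to All++)
open import Data.List.Relation.Unary.Unique.Propositional using (Unique)
import Data.List.Relation.Unary.Unique.Propositional.Properties as Unique
open import Data.List.Relation.Unary.Unique.Propositional.Properties using (upTo⁺)
open import Data.List.Relation.Unary.AllPairs using ([]; _∷_)
open import Data.List.Relation.Binary.Permutation.Propositional
  using (_↭_; ↭-refl; ↭-sym; ↭-prep; module PermutationReasoning)
open import Data.List.Relation.Binary.Permutation.Propositional.Properties
  using (↭-length; filter-↭; shifts; All-resp-↭; ∈-resp-↭)
  renaming (map⁺ to ↭-map⁺; ++-commutativeMonoid to ↭-++-commutativeMonoid; ++-comm to ↭-++-comm;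
            ++⁺ˡ to ↭-++⁺ˡ; ++⁺ʳ to ↭-++⁺ʳ; ++⁺ to ↭-++⁺)
import Data.Product as Prod
open import Data.Product using (Σ; _×_; _,_; proj₁; proj₂)
open import Relation.Nullary using (Dec; yes; no)
open import Function using (_∘_)
open import Relation.Binary.Construct.Closure.ReflexiveTransitive using (Star; ε; _◅_; _◅◅_; gmap)
open import Data.List.Relation.Binary.Subset.Propositional using (_⊆_)
open import Data.List.Relation.Binary.Disjoint.Propositional using (Disjoint)
open import Relation.Binary.PropositionalEquality hiding ([_])
open import Data.Nat.Tactic.RingSolver using (solve-∀)
open import Algebra.Bundles using (CommutativeMonoid)
import Algebra.Properties.CommutativeSemigroup as CommutativeSemigroupProperties
open CommutativeSemigroupProperties (CommutativeMonoid.commutativeSemigroup (↭-++-commutativeMonoid {A = Label}))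
  using () renaming (interchange to ↭-interchange)
open CommutativeSemigroupProperties +-commutativeSemigroup using () renaming (interchange to +-interchange)

splitAt-lengths : ∀ {A : Set} m {n} (xs : List A) → length xs ≡ m + n →
  length (proj₁ (splitAt m xs)) ≡ m × length (proj₂ (splitAt m xs)) ≡ n
splitAt-lengths zero xs eq = refl , eq
splitAt-lengths (suc m) [] ()
splitAt-lengths (suc m) (x ∷ xs) eq = Prod.map₁ (cong suc) (splitAt-lengths m xs (suc-injective eq))

-- Splitting the head-block of a non-empty list: the CPS translation splits
-- the tail of a label list at n ∸ 1 where the Int-interpretation splits the
-- whole list at n.
splitAt-cons : ∀ {A : Set} {n k} (x : A) xs → n ≡ suc k →
  splitAt n (x ∷ xs) ≡ Prod.map₁ (x ∷_) (splitAt (n ∸ 1) xs)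
splitAt-cons x xs refl = refl

zip-splitAt : ∀ {A B : Set} n (xs : List A) (ys : List B) → length xs ≡ length ys →
  zip xs ys ≡ zip (proj₁ (splitAt n xs)) (proj₁ (splitAt n ys)) ++ zip (proj₂ (splitAt n xs)) (proj₂ (splitAt n ys))
zip-splitAt zero xs ys eq = refl
zip-splitAt (suc n) [] [] eq = refl
zip-splitAt (suc n) (x ∷ xs) (y ∷ ys) eq = cong ((x , y) ∷_) (zip-splitAt n xs ys (suc-injective eq))

splitAt-join : ∀ {A : Set} n (xs : List A) → proj₁ (splitAt n xs) ++ proj₂ (splitAt n xs) ≡ xs
splitAt-join n xs = trans (cong (λ s → proj₁ s ++ proj₂ s) (splitAt-defn n xs)) (take++drop≡id n xs)

map-proj₁-zip : ∀ {A B : Set} (xs : List A) (ys : List B) → length xs ≡ length ys → map proj₁ (zip xs ys) ≡ xs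
map-proj₁-zip [] [] eq = refl
map-proj₁-zip (x ∷ xs) (y ∷ ys) eq = cong (x ∷_) (map-proj₁-zip xs ys (suc-injective eq))

cons-view : ∀ {A : Set} {k} (xs : List A) → length xs ≡ suc k → Σ A λ x → Σ (List A) λ r → xs ≡ x ∷ r
cons-view (x ∷ xs) eq = x , xs , refl

-- Occurrence counts of labels, used to show that labels are defined at most once.

_≟L_ : (a b : Label) → Dec (a ≡ b)
top m ≟L top n with m ℕ.≟ n
... | yes refl = yes refl
... | no m≢n = no λ { refl → m≢n refl }
top _ ≟L loc _ _ = no λ ()
loc _ _ ≟L top _ = no λ ()
loc p m ≟L loc q n with ≡-dec ℕ._≟_ p q | m ℕ.≟ n
... | yes refl | yes refl = yes refl
... | no p≢q | _ = no λ { refl → p≢q refl }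
... | _ | no m≢n = no λ { refl → m≢n refl }

occ : Label → List Label → ℕ
occ a xs = length (filter (a ≟L_) xs)

occ-++ : ∀ a xs ys → occ a (xs ++ ys) ≡ occ a xs + occ a ys
occ-++ a xs ys = trans (cong length (filter-++ (a ≟L_) xs ys)) (length-++ (filter (a ≟L_) xs))

occ-cons : ∀ a x xs → occ a (x ∷ xs) ≡ occ a [ x ] + occ a xs
occ-cons a x xs = occ-++ a [ x ] xs

occ-↭ : ∀ a {xs ys} → xs ↭ ys → occ a xs ≡ occ a ys
occ-↭ a p = ↭-length (filter-↭ (a ≟L_) p)

occ-insert : ∀ a xs ys zs → occ a (xs ++ zs) ≤ occ a (xs ++ (ys ++ zs))
occ-insert a xs ys zs = begin
  occ a (xs ++ zs)                 ≡⟨ occ-++ a xs zs ⟩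
  occ a xs + occ a zs              ≤⟨ +-monoʳ-≤ (occ a xs) (m≤n+m (occ a zs) (occ a ys)) ⟩
  occ a xs + (occ a ys + occ a zs) ≡⟨ cong (occ a xs +_) (occ-++ a ys zs) ⟨
  occ a xs + occ a (ys ++ zs)      ≡⟨ occ-++ a xs (ys ++ zs) ⟨
  occ a (xs ++ (ys ++ zs))         ∎
  where open ≤-Reasoning

occ-self : ∀ a → occ a [ a ] ≡ 1
occ-self a with a ≟L a
... | yes _ = refl
... | no a≢a = ⊥-elim (a≢a refl)

occ-∉ : ∀ {a} xs → a ∉ xs → occ a xs ≡ 0
occ-∉ [] a∉ = refl
occ-∉ {a} (x ∷ xs) a∉ with a ≟L x
... | yes refl = ⊥-elim (a∉ (here refl))
... | no _ = occ-∉ xs (λ m → a∉ (there m))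

∈⇒occ : ∀ {a xs} → a ∈ xs → 1 ≤ occ a xs
∈⇒occ {a} {x ∷ xs} (here refl) rewrite occ-cons a a xs | occ-self a = s≤s z≤n
∈⇒occ {a} {x ∷ xs} (there m) rewrite occ-cons a x xs = ≤-trans (∈⇒occ m) (m≤n+m _ _)

occ≤1⇒Unique : ∀ xs → (∀ a → occ a xs ≤ 1) → Unique xs
occ≤1⇒Unique [] _ = []
occ≤1⇒Unique (x ∷ xs) bound = All.tabulate x≢ ∷ occ≤1⇒Unique xs bound′
  where
  bound′ : ∀ a → occ a xs ≤ 1
  bound′ a = ≤-trans (m≤n+m _ _) (≤-trans (≤-reflexive (sym (occ-cons a x xs))) (bound a))
  x≢ : ∀ {y} → y ∈ xs → x ≢ y
  x≢ m refl = <-irrefl refl (begin-strict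
    1                      <⟨ s≤s (∈⇒occ m) ⟩
    1 + occ x xs           ≡⟨ cong (_+ occ x xs) (occ-self x) ⟨
    occ x [ x ] + occ x xs ≡⟨ occ-cons x x xs ⟨
    occ x (x ∷ xs)         ≤⟨ bound x ⟩
    1                      ∎)
    where open ≤-Reasoning

Unique⇒occ≤1 : ∀ a {xs} → Unique xs → occ a xs ≤ 1
Unique⇒occ≤1 a {[]} [] = z≤n
Unique⇒occ≤1 a {x ∷ xs} (x∉ ∷ u) with a ≟L x
... | no _ = Unique⇒occ≤1 a u
... | yes refl = ≤-reflexive (cong suc (occ-∉ xs λ m → All.lookup x∉ m refl))

block : (ℕ → Label) → ℕ → ℕ → List Label
block f s n = map (λ i → f (s + i)) (upTo n)

map-upTo-+ : ∀ {A : Set} (g : ℕ → A) m n → map g (upTo (m + n)) ≡ map g (upTo m) ++ map (λ i → g (m + i)) (upTo n)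
map-upTo-+ g zero n = refl
map-upTo-+ g (suc m) n = cong (g 0 ∷_) (begin
  map g (applyUpTo suc (m + n))                                   ≡⟨ shift g (m + n) ⟩
  map (g ∘ suc) (upTo (m + n))                                    ≡⟨ map-upTo-+ (g ∘ suc) m n ⟩
  map (g ∘ suc) (upTo m) ++ map (λ i → g (suc (m + i))) (upTo n)
    ≡⟨ cong (_++ map (λ i → g (suc (m + i))) (upTo n)) (shift g m) ⟨
  map g (applyUpTo suc m) ++ map (λ i → g (suc (m + i))) (upTo n) ∎)
  where
  open ≡-Reasoning
  shift : ∀ {A : Set} (g : ℕ → A) k → map g (applyUpTo suc k) ≡ map (g ∘ suc) (upTo k)
  shift g k = trans (map-applyUpTo suc g k) (sym (map-upTo (g ∘ suc) k))

length-block : ∀ f s n → length (block f s n) ≡ n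
length-block f s n = trans (length-map _ (upTo n)) (length-upTo n)

block-split : ∀ f s m n → block f s (m + n) ≡ block f s m ++ block f (s + m) n
block-split f s m n = trans (map-upTo-+ (λ i → f (s + i)) m n)
  (cong (block f s m ++_) (map-cong (λ i → cong f (sym (+-assoc s m i))) (upTo n)))

block-unique : ∀ {f} → (∀ {i j} → f i ≡ f j → i ≡ j) → ∀ s n → Unique (block f s n)
block-unique f-inj s n = Unique.map⁺ (λ eq → +-cancelˡ-≡ s _ _ (f-inj eq)) (upTo⁺ n)

block-∉ : ∀ {a} f s n → (∀ i → a ≢ f i) → a ∉ block f s n
block-∉ f s n a≢ m with ∈-map⁻ _ m
... | i , _ , eq = a≢ (s + i) eq

-- Every interface X⁻ is non-empty: its first label is the one that
-- the CPS translation uses for the continuation.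
minus-nonEmpty : ∀ X → Σ ℕ λ k → #⁻ X ≡ suc k
minus-nonEmpty one = 0 , refl
minus-nonEmpty (X ⇒ Y) with minus-nonEmpty Y
... | k , eq = k + #⁺ X , trans (length-++ (minus Y)) (cong (_+ #⁺ X) eq)

#⁻-⇒ : ∀ X Y → #⁻ (X ⇒ Y) ≡ #⁻ Y + #⁺ X
#⁻-⇒ X Y = length-++ (minus Y)

#⁺-⇒ : ∀ X Y → #⁺ (X ⇒ Y) ≡ #⁺ Y + #⁻ X
#⁺-⇒ X Y = length-++ (plus Y)

#⁻-⇒-pred : ∀ X Y → #⁻ (X ⇒ Y) ∸ 1 ≡ (#⁻ Y ∸ 1) + #⁺ X
#⁻-⇒-pred X Y rewrite #⁻-⇒ X Y | proj₂ (minus-nonEmpty Y) = refl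

Fits : Ty → List Label → List Label → Set
Fits X m p = length m ≡ #⁻ X × length p ≡ #⁺ X

mutual
  minus-units : ∀ X → All (_≡ unit) (minus X)
  minus-units one = refl ∷ []
  minus-units (X ⇒ Y) = All++ (minus-units Y) (plus-units X)

  plus-units : ∀ X → All (_≡ unit) (plus X)
  plus-units one = refl ∷ []
  plus-units (X ⇒ Y) = All++ (plus-units Y) (minus-units X)

-- Defunctionalising terms of the shape produced by the CPS translation
-- succeeds, and erasing the result leaves one jump per abstraction.

-- a jump f(…) = g(…) of a program, recorded by its two labels
Edge : Set
Edge = Label × Label

tailLabel : LTerm → Label
tailLabel (lapp l _ _) = l
tailLabel (llet _ _ _ u) = tailLabel u
tailLabel _ = top 0

-- The jumps of the defunctionalised term: an abstraction λˡx.u contributes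
-- the definition apply_l(…) = apply_g(…) where g is the tail label of u.
cpsEdges : LTerm → List Edge
cpsEdges (lvar x) = []
cpsEdges lstar = []
cpsEdges (lpair a b) = cpsEdges a ++ cpsEdges b
cpsEdges (llet e x y u) = cpsEdges e ++ cpsEdges u
cpsEdges (lapp l a b) = cpsEdges a ++ cpsEdges b
cpsEdges (llam l x u) = cpsEdges u ++ (l , tailLabel u) ∷ []

-- Terms in the image of the CPS translation: applications only occur in
-- tail position of abstraction bodies, applied to application-free terms.
mutual
  data Pure : LTerm → Set where
    pvar  : ∀ {x} → Pure (lvar x)
    pstar : Pure lstar
    ppair : ∀ {a b} → Pure a → Pure b → Pure (lpair a b)
    plet  : ∀ {e x y u} → Pure e → Pure u → Pure (llet e x y u)
    plam  : ∀ {l x u} → Tail u → Pure (llam l x u)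

  data Tail : LTerm → Set where
    tapp : ∀ {l a b} → Pure a → Pure b → Tail (lapp l a b)
    tlet : ∀ {e x y u} → Pure e → Tail u → Tail (llet e x y u)

erasedJump : Edge → Def
erasedJump (f , g) = jump f (aux 0) g unitE

DefunErases : LTerm → Set
DefunErases t = Σ (List Def) λ ds →
  (mapM toDef (proj₂ (defun t)) ≡ just ds) × (mapMaybe eraseDef ds ≡ map erasedJump (cpsEdges t))

mapM-++ : ∀ {A B : Set} (f : A → Maybe B) xs ys {bs cs} →
  mapM f xs ≡ just bs → mapM f ys ≡ just cs → mapM f (xs ++ ys) ≡ just (bs ++ cs)
mapM-++ f [] ys refl q = q
mapM-++ f (x ∷ xs) ys p q with f x
... | just b with mapM f xs in eq
mapM-++ f (x ∷ xs) ys refl q | just b | just bs rewrite mapM-++ f xs ys eq q = refl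

defunErases-++ : ∀ {a b} → DefunErases a → DefunErases b →
  Σ (List Def) λ ds → (mapM toDef (proj₂ (defun a) ++ proj₂ (defun b)) ≡ just ds) ×
                      (mapMaybe eraseDef ds ≡ map erasedJump (cpsEdges a ++ cpsEdges b))
defunErases-++ {a} {b} (da , ta , ea) (db , tb , eb) =
  da ++ db , mapM-++ toDef (proj₂ (defun a)) (proj₂ (defun b)) ta tb ,
  trans (mapMaybe-++ eraseDef da db) (trans (cong₂ _++_ ea eb) (sym (map-++ erasedJump (cpsEdges a) (cpsEdges b))))

tuple-pure : ∀ xs → Σ Exp λ e → pureE (tuple xs) ≡ just e
tuple-pure [] = _ , refl
tuple-pure (x ∷ xs) with tuple-pure xs
... | e , eq rewrite eq = _ , refl

mutual
  pure-defun : ∀ {t} → Pure t → (Σ Exp λ e → pureE (proj₁ (defun t)) ≡ just e) × DefunErases t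
  pure-defun pvar = (_ , refl) , [] , refl , refl
  pure-defun pstar = (_ , refl) , [] , refl , refl
  pure-defun {lpair a b} (ppair pa pb) with pure-defun pa | pure-defun pb
  ... | (_ , ea) , da | (_ , eb) , db rewrite ea | eb = (_ , refl) , defunErases-++ {a} {b} da db
  pure-defun {llet a _ _ b} (plet pa pb) with pure-defun pa | pure-defun pb
  ... | (_ , ea) , da | (_ , eb) , db rewrite ea | eb = (_ , refl) , defunErases-++ {a} {b} da db
  pure-defun {llam l x u} (plam tu) with tail-defun tu
  ... | (e , eu) , (ds , tds , eds) =
    tuple-pure (fv (llam l x u)) , ds ++ _ ∷ [] , mapM-++ toDef (proj₂ (defun u)) _ tds body ,
    trans (mapMaybe-++ eraseDef ds _) (trans (cong (_++ _) eds) (sym (map-++ erasedJump (cpsEdges u) _)))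
    where
    body : mapM toDef (ddef l (fv (llam l x u)) x (proj₁ (defun u)) ∷ []) ≡
           just (jump l (aux 0) (tailLabel u) (letP (var (aux 0)) (aux 1) x (unpack 1 (fv (llam l x u)) e)) ∷ [])
    body rewrite eu = refl

  tail-defun : ∀ {t} → Tail t → (Σ Exp λ e → tailE (proj₁ (defun t)) ≡ just (tailLabel t , e)) × DefunErases t
  tail-defun {lapp _ a b} (tapp pa pb) with pure-defun pa | pure-defun pb
  ... | (_ , ea) , da | (_ , eb) , db rewrite ea | eb = (_ , refl) , defunErases-++ {a} {b} da db
  tail-defun {llet a _ _ b} (tlet pa tb) with pure-defun pa | tail-defun tb
  ... | (_ , ea) , da | (_ , eb) , db rewrite ea | eb = (_ , refl) , defunErases-++ {a} {b} da db

-- η-expansion of a variable: its jumps forward every label of one copy of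
-- the interface to the corresponding label of the other.

-- Two labelled types that differ only in their labels; ol and ul produce
-- only 1, products and negations.
data SameShape : LTy → LTy → Set where
  same-one  : SameShape one' one'
  same-prod : ∀ {a b c d} → SameShape a c → SameShape b d → SameShape (prod a b) (prod c d)
  same-neg  : ∀ {l l′ a c} → SameShape a c → SameShape (neg l a) (neg l′ c)

-- η-expansion is contravariant in argument positions, where the two types swap roles
SameShape-sym : ∀ {s t} → SameShape s t → SameShape t s
SameShape-sym same-one = same-one
SameShape-sym (same-prod s t) = same-prod (SameShape-sym s) (SameShape-sym t)
SameShape-sym (same-neg s) = same-neg (SameShape-sym s)

mutual
  ol-shape : ∀ X m p m′ p′ → SameShape (ol X m p) (ol X m′ p′)
  ol-shape X m p m′ p′ = same-neg (ul-shape X (tl m) p (tl m′) p′)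

  ul-shape : ∀ X m p m′ p′ → SameShape (ul X m p) (ul X m′ p′)
  ul-shape one m p m′ p′ = same-neg same-one
  ul-shape (X ⇒ Y) m p m′ p′ =
    same-prod (ol-shape X (proj₂ (splitAt (#⁺ Y) p)) (proj₂ (splitAt (#⁻ Y ∸ 1) m))
                          (proj₂ (splitAt (#⁺ Y) p′)) (proj₂ (splitAt (#⁻ Y ∸ 1) m′)))
              (ul-shape Y _ _ _ _)

-- The jumps created by η-expanding a variable from type s to type t: each
-- negation ¬ₗ in t is implemented by a jump to the matching label of s.
etaEdges : LTy → LTy → List Edge
etaEdges (prod s₁ s₂) (prod t₁ t₂) = etaEdges s₁ t₁ ++ etaEdges s₂ t₂
etaEdges (arr l₁ s₁ s₂) (arr l₂ t₁ t₂) = etaEdges t₁ s₁ ++ (l₂ , l₁) ∷ []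
etaEdges _ _ = []

eta-cps : ∀ q y {s t} → SameShape s t →
  Pure (eta q (lvar y) s t) × (cpsEdges (eta q (lvar y) s t) ≡ etaEdges s t)
eta-cps q y same-one = pvar , refl
eta-cps q y (same-prod s₁ s₂) with eta-cps (0 ∷ q) (gen q 0) s₁ | eta-cps (1 ∷ q) (gen q 1) s₂
... | p₁ , e₁ | p₂ , e₂ = plet pvar (ppair p₁ p₂) , cong₂ _++_ e₁ e₂
eta-cps q y (same-neg s) with eta-cps (0 ∷ q) (gen q 0) (SameShape-sym s)
... | p , e = plam (tapp pvar p) , cong (_++ _) e

regroup : ∀ (P Q R S : List Edge) → (P ++ Q) ++ (R ++ S) ↭ (R ++ Q) ++ (S ++ P)
regroup P Q R S = begin
  (P ++ Q) ++ (R ++ S)   ↭⟨ ↭-++-comm (P ++ Q) (R ++ S) ⟩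
  (R ++ S) ++ (P ++ Q)   ≡⟨ ++-assoc R S (P ++ Q) ⟩
  R ++ (S ++ (P ++ Q))   ↭⟨ ↭-++⁺ˡ R (↭-++⁺ˡ S (↭-++-comm P Q)) ⟩
  R ++ (S ++ (Q ++ P))   ↭⟨ ↭-++⁺ˡ R (shifts S Q) ⟩
  R ++ (Q ++ (S ++ P))   ≡⟨ ++-assoc R Q (S ++ P) ⟨
  (R ++ Q) ++ (S ++ P)   ∎
  where open PermutationReasoning

-- η-expanding x : X̄[s⁻, s⁺] to X̄[t⁻, t⁺] jumps from every label of the
-- continuation-side blocks t⁻, s⁺ to the corresponding label of s⁻, t⁺:
-- up to order, this is exactly the forwarding of the (ax) rule.
mutual
  ol-etaEdges : ∀ X mS pS mT pT → Fits X mS pS → Fits X mT pT →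
    etaEdges (ol X mS pS) (ol X mT pT) ↭ zip mT mS ++ zip pS pT
  ol-etaEdges X mS pS mT pT (lmS , lpS) (lmT , lpT) with minus-nonEmpty X
  ... | k , ek with cons-view mS (trans lmS ek) | cons-view mT (trans lmT ek)
  ... | s , mS′ , refl | t , mT′ , refl = begin
    etaEdges (ul X mT′ pT) (ul X mS′ pS) ++ (t , s) ∷ []
      ↭⟨ ↭-++⁺ʳ _ (ul-etaEdges X mT′ pT mS′ pS (cong (_∸ 1) lmT) lpT (cong (_∸ 1) lmS) lpS) ⟩
    (zip mT′ mS′ ++ zip pS pT) ++ (t , s) ∷ []
      ↭⟨ ↭-++-comm _ ((t , s) ∷ []) ⟩
    (t , s) ∷ (zip mT′ mS′ ++ zip pS pT) ∎
    where open PermutationReasoning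

  ul-etaEdges : ∀ X mA pA mB pB →
    length mA ≡ #⁻ X ∸ 1 → length pA ≡ #⁺ X → length mB ≡ #⁻ X ∸ 1 → length pB ≡ #⁺ X →
    etaEdges (ul X mA pA) (ul X mB pB) ↭ zip mA mB ++ zip pB pA
  ul-etaEdges one [] (a ∷ []) [] (b ∷ []) _ _ _ _ = ↭-refl
  ul-etaEdges (X ⇒ Y) mA pA mB pB lmA lpA lmB lpB = begin
    etaEdges (ol X dpA dmA) (ol X dpB dmB) ++ etaEdges (ul Y tmA tpA) (ul Y tmB tpB)
      ↭⟨ ↭-++⁺ (ol-etaEdges X dpA dmA dpB dmB (ldpA , ldmA) (ldpB , ldmB))
               (ul-etaEdges Y tmA tpA tmB tpB ltmA ltpA ltmB ltpB) ⟩
    (zip dpB dpA ++ zip dmA dmB) ++ (zip tmA tmB ++ zip tpB tpA)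
      ↭⟨ regroup (zip dpB dpA) (zip dmA dmB) (zip tmA tmB) (zip tpB tpA) ⟩
    (zip tmA tmB ++ zip dmA dmB) ++ (zip tpB tpA ++ zip dpB dpA)
      ≡⟨ cong₂ _++_ (zip-splitAt k mA mB (trans lmA (sym lmB))) (zip-splitAt (#⁺ Y) pB pA (trans lpB (sym lpA))) ⟨
    zip mA mB ++ zip pB pA ∎
    where
    open PermutationReasoning
    k = #⁻ Y ∸ 1
    tmA = proj₁ (splitAt k mA) ; dmA = proj₂ (splitAt k mA)
    tmB = proj₁ (splitAt k mB) ; dmB = proj₂ (splitAt k mB)
    tpA = proj₁ (splitAt (#⁺ Y) pA) ; dpA = proj₂ (splitAt (#⁺ Y) pA)
    tpB = proj₁ (splitAt (#⁺ Y) pB) ; dpB = proj₂ (splitAt (#⁺ Y) pB)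
    ltmA = proj₁ (splitAt-lengths k mA (trans lmA (#⁻-⇒-pred X Y)))
    ldmA = proj₂ (splitAt-lengths k mA (trans lmA (#⁻-⇒-pred X Y)))
    ltmB = proj₁ (splitAt-lengths k mB (trans lmB (#⁻-⇒-pred X Y)))
    ldmB = proj₂ (splitAt-lengths k mB (trans lmB (#⁻-⇒-pred X Y)))
    ltpA = proj₁ (splitAt-lengths (#⁺ Y) pA (trans lpA (#⁺-⇒ X Y)))
    ldpA = proj₂ (splitAt-lengths (#⁺ Y) pA (trans lpA (#⁺-⇒ X Y)))
    ltpB = proj₁ (splitAt-lengths (#⁺ Y) pB (trans lpB (#⁺-⇒ X Y)))
    ldpB = proj₂ (splitAt-lengths (#⁺ Y) pB (trans lpB (#⁺-⇒ X Y)))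

cps-pure : ∀ {Γ t X} (d : Γ ⊢ t ∶ X) p xm xp cl → Pure (cps d p xm xp cl)
cps-pure (ax {x} {X}) p xm xp cl =
  proj₁ (eta-cps p (src x) (ol-shape X (proj₁ (headC cl)) (proj₂ (headC cl)) xm xp))
cps-pure oneI p xm xp cl = plam (tapp pvar pstar)
cps-pure (weak _ d) p xm xp cl = cps-pure d _ _ _ _
cps-pure (exch d) p xm xp cl = cps-pure d _ _ _ _
cps-pure (lamI _ d) p xm xp cl = plam (tlet pvar (tapp (cps-pure d _ _ _ _) pvar))
cps-pure (appE _ ds dt) p xm xp cl = plam (tapp (cps-pure ds _ _ _ _) (ppair (cps-pure dt _ _ _ _) pvar))

defEdges : List Def → List Edge
defEdges [] = []
defEdges (jump f _ g _ ∷ ds) = (f , g) ∷ defEdges ds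
defEdges (branch _ _ _ _ _ _ _ _ _ ∷ ds) = defEdges ds

defEdges-++ : ∀ ds es → defEdges (ds ++ es) ≡ defEdges ds ++ defEdges es
defEdges-++ [] es = refl
defEdges-++ (jump _ _ _ _ ∷ ds) es = cong (_ ∷_) (defEdges-++ ds es)
defEdges-++ (branch _ _ _ _ _ _ _ _ _ ∷ ds) es = defEdges-++ ds es

defEdges-fwds : ∀ xs ys → defEdges (fwds xs ys) ≡ zip xs ys
defEdges-fwds [] ys = refl
defEdges-fwds (x ∷ xs) [] = refl
defEdges-fwds (x ∷ xs) (y ∷ ys) = cong (_ ∷_) (defEdges-fwds xs ys)

intEdges : ∀ {Γ t X} → Γ ⊢ t ∶ X → Addr → List Label → List Label → CLabs → List Edge
intEdges d p xm xp cl = defEdges (intD d p xm xp cl)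

FitsC : Ctx → CLabs → Set
FitsC [] [] = ⊤
FitsC ((_ , X) ∷ Γ) ((m , q) ∷ cl) = Fits X m q × FitsC Γ cl
FitsC _ _ = ⊥

FitsC-split : ∀ Δ Γ cl → FitsC (Δ ++ Γ) cl →
  FitsC Δ (proj₁ (splitAt (length Δ) cl)) × FitsC Γ (proj₂ (splitAt (length Δ) cl))
FitsC-split [] Γ cl fits = tt , fits
FitsC-split (_ ∷ Δ) Γ (c ∷ cl) (fc , fits) = Prod.map₁ (fc ,_) (FitsC-split Δ Γ cl fits)

FitsC-swap : ∀ Δ a b Γ cl → FitsC (Δ ++ b ∷ a ∷ Γ) cl → FitsC (Δ ++ a ∷ b ∷ Γ) (swapAt (length Δ) cl)
FitsC-swap [] a b Γ (c₁ ∷ c₂ ∷ cl) (f₁ , f₂ , fits) = f₂ , f₁ , fits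
FitsC-swap (_ ∷ Δ) a b Γ (c ∷ cl) (fc , fits) = fc , FitsC-swap Δ a b Γ cl fits

fits-lam : ∀ X Y {xm xp} → Fits (X ⇒ Y) xm xp →
  Fits Y (proj₁ (splitAt (#⁻ Y) xm)) (proj₁ (splitAt (#⁺ Y) xp)) ×
  Fits X (proj₂ (splitAt (#⁺ Y) xp)) (proj₂ (splitAt (#⁻ Y) xm))
fits-lam X Y {xm} {xp} (lxm , lxp) with splitAt-lengths (#⁻ Y) xm (trans lxm (#⁻-⇒ X Y))
                                      | splitAt-lengths (#⁺ Y) xp (trans lxp (#⁺-⇒ X Y))
... | lm₁ , lm₂ | lp₁ , lp₂ = (lm₁ , lp₁) , (lp₂ , lm₂)

fits-app : ∀ X Y {ym yp lm lp} → Fits Y ym yp → Fits X lm lp → Fits (X ⇒ Y) (ym ++ lp) (yp ++ lm)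
fits-app X Y {ym} {yp} (lym , lyp) (llm , llp) =
  trans (length-++ ym) (trans (cong₂ _+_ lym llp) (sym (#⁻-⇒ X Y))) ,
  trans (length-++ yp) (trans (cong₂ _+_ lyp llm) (sym (#⁺-⇒ X Y)))

app-intEdges : ∀ {Γ Δ s t X Y} (fr : Disjoint (names Γ) (names Δ)) (ds : Γ ⊢ s ∶ X ⇒ Y) (dt : Δ ⊢ t ∶ X) p xm xp cl →
  intEdges (appE fr ds dt) p xm xp cl ≡
    intEdges ds (0 ∷ p) (xm ++ fresh p (#⁻ X) (#⁺ X)) (xp ++ fresh p 0 (#⁻ X)) (proj₂ (splitAt (length Δ) cl)) ++
    intEdges dt (1 ∷ p) (fresh p 0 (#⁻ X)) (fresh p (#⁻ X) (#⁺ X)) (proj₁ (splitAt (length Δ) cl))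
app-intEdges {Δ = Δ} {X = X} fr ds dt p xm xp cl =
  defEdges-++ (intD ds (0 ∷ p) (xm ++ fresh p (#⁻ X) (#⁺ X)) (xp ++ fresh p 0 (#⁻ X)) (proj₂ (splitAt (length Δ) cl)))
              (intD dt (1 ∷ p) (fresh p 0 (#⁻ X)) (fresh p (#⁻ X) (#⁺ X)) (proj₁ (splitAt (length Δ) cl)))

-- The CPS translation of the node at address p reserves loc p 0 for the
-- continuation it passes to its children, so its fresh labels are those of
-- the Int-interpretation shifted by one: φ maps Int labels to CPS labels and
-- ψ is a left inverse, sending loc p 0 to the Int label it stands for.
φ : Label → Label
φ (top n) = top n
φ (loc p n) = loc p (suc n)

-- the Int label of the head of the X⁻ block of the node at address p
ψhead : Addr → Label
ψhead [] = top 0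
ψhead (zero ∷ p) = ψhead p
ψhead (suc _ ∷ p) = loc p 0

ψ : Label → Label
ψ (top n) = top n
ψ (loc p zero) = ψhead p
ψ (loc p (suc n)) = loc p n

ψ∘φ : ∀ a → ψ (φ a) ≡ a
ψ∘φ (top n) = refl
ψ∘φ (loc p n) = refl

φL : List Label → List Label
φL = map φ

φC : CLabs → CLabs
φC = map (Prod.map φL φL)

φ² : Edge → Edge
φ² = Prod.map φ φ

φL-fresh : ∀ p s n → φL (fresh p s n) ≡ fresh p (suc s) n
φL-fresh p s n = sym (map-∘ (upTo n))

swapAt-map : ∀ {A B : Set} (f : A → B) n xs → swapAt n (map f xs) ≡ map f (swapAt n xs)
swapAt-map f zero [] = refl
swapAt-map f zero (x ∷ []) = refl
swapAt-map f zero (x ∷ y ∷ xs) = refl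
swapAt-map f (suc n) [] = refl
swapAt-map f (suc n) (x ∷ xs) = cong (f x ∷_) (swapAt-map f n xs)

Shifted : Label → List Label → List Label → CLabs → List Label → List Label → CLabs → Set
Shifted h xm xp cl xmC xpC clC = (xmC ≡ h ∷ φL (tl xm)) × (xpC ≡ φL xp) × (clC ≡ φC cl)

ax-cpsEdges : ∀ X x p h x₀ xs c₀ cs cp xp → Fits X (x₀ ∷ xs) xp → Fits X (c₀ ∷ cs) cp →
  cpsEdges (cps (ax {x} {X}) p (h ∷ φL xs) (φL xp) (φC ((c₀ ∷ cs , cp) ∷ [])))
    ↭ (h , φ c₀) ∷ map φ² (zip xs cs ++ zip cp xp)
ax-cpsEdges X x p h x₀ xs c₀ cs cp xp (lxm , lxp) (lcm , lcp) = begin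
  cpsEdges (eta p (lvar (src x)) (ol X cmC cpC) (ol X xmC xpC))
    ≡⟨ proj₂ (eta-cps p (src x) (ol-shape X cmC cpC xmC xpC)) ⟩
  etaEdges (ol X cmC cpC) (ol X xmC xpC)
    ↭⟨ ol-etaEdges X cmC cpC xmC xpC
         (trans (length-map φ (c₀ ∷ cs)) lcm , trans (length-map φ cp) lcp)
         (trans (cong suc (length-map φ xs)) lxm , trans (length-map φ xp) lxp) ⟩
  (h , φ c₀) ∷ (zip (φL xs) (φL cs) ++ zip (φL cp) (φL xp))
    ≡⟨ cong ((h , φ c₀) ∷_) (trans (cong₂ _++_ (zip-map φ φ xs cs) (zip-map φ φ cp xp))
                                   (sym (map-++ φ² (zip xs cs) (zip cp xp)))) ⟩
  (h , φ c₀) ∷ map φ² (zip xs cs ++ zip cp xp) ∎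
  where
  open PermutationReasoning
  cmC = φL (c₀ ∷ cs) ; cpC = φL cp ; xmC = h ∷ φL xs ; xpC = φL xp

ax-intEdges : ∀ X x p x₀ xs c₀ cs cp xp →
  intEdges (ax {x} {X}) p (x₀ ∷ xs) xp ((c₀ ∷ cs , cp) ∷ []) ≡ (x₀ , c₀) ∷ (zip xs cs ++ zip cp xp)
ax-intEdges X x p x₀ xs c₀ cs cp xp =
  cong ((x₀ , c₀) ∷_) (trans (defEdges-++ (fwds xs cs) (fwds cp xp)) (cong₂ _++_ (defEdges-fwds xs cs) (defEdges-fwds cp xp)))

lam-shifted : ∀ Y p x₀ xs xp cl →
  Shifted (loc p 0) (proj₁ (splitAt (#⁻ Y) (x₀ ∷ xs))) (proj₁ (splitAt (#⁺ Y) xp))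
          ((proj₂ (splitAt (#⁺ Y) xp) , proj₂ (splitAt (#⁻ Y) (x₀ ∷ xs))) ∷ cl)
          (loc p 0 ∷ proj₁ (splitAt (#⁻ Y ∸ 1) (φL xs))) (proj₁ (splitAt (#⁺ Y) (φL xp)))
          ((proj₂ (splitAt (#⁺ Y) (φL xp)) , proj₂ (splitAt (#⁻ Y ∸ 1) (φL xs))) ∷ φC cl)
lam-shifted Y p x₀ xs xp cl =
  cong (loc p 0 ∷_) (trans (cong proj₁ (splitAt-map φ (#⁻ Y ∸ 1) xs)) (cong (φL ∘ tl ∘ proj₁) (sym split-xm))) ,
  cong proj₁ (splitAt-map φ (#⁺ Y) xp) ,
  cong (_∷ φC cl) (cong₂ _,_ (cong proj₂ (splitAt-map φ (#⁺ Y) xp))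
                             (trans (cong proj₂ (splitAt-map φ (#⁻ Y ∸ 1) xs)) (cong (φL ∘ proj₂) (sym split-xm))))
  where split-xm = splitAt-cons x₀ xs (proj₂ (minus-nonEmpty Y))

lam-head : ∀ Y x₀ xs → hd (proj₁ (splitAt (#⁻ Y) (x₀ ∷ xs))) ≡ x₀
lam-head Y x₀ xs = cong (hd ∘ proj₁) (splitAt-cons x₀ xs (proj₂ (minus-nonEmpty Y)))

app-shifted-fun : ∀ X n p y₀ ys xp cl →
  Shifted (loc p 0) ((y₀ ∷ ys) ++ fresh p (#⁻ X) (#⁺ X)) (xp ++ fresh p 0 (#⁻ X)) (proj₂ (splitAt n cl))
          (loc p 0 ∷ (φL ys ++ fresh p (1 + #⁻ X) (#⁺ X))) (φL xp ++ fresh p 1 (#⁻ X)) (proj₂ (splitAt n (φC cl)))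
app-shifted-fun X n p y₀ ys xp cl =
  cong (loc p 0 ∷_) (trans (cong (φL ys ++_) (sym (φL-fresh p (#⁻ X) (#⁺ X)))) (sym (map-++ φ ys _))) ,
  trans (cong (φL xp ++_) (sym (φL-fresh p 0 (#⁻ X)))) (sym (map-++ φ xp _)) ,
  cong proj₂ (splitAt-map (Prod.map φL φL) n cl)

app-shifted-arg : ∀ X n p cl →
  Shifted (φ (hd (fresh p 0 (#⁻ X)))) (fresh p 0 (#⁻ X)) (fresh p (#⁻ X) (#⁺ X)) (proj₁ (splitAt n cl))
          (fresh p 1 (#⁻ X)) (fresh p (1 + #⁻ X) (#⁺ X)) (proj₁ (splitAt n (φC cl)))
app-shifted-arg X n p cl with #⁻ X | minus-nonEmpty X
... | _ | k , refl =
  sym (φL-fresh p 0 (suc k)) , sym (φL-fresh p (suc k) (#⁺ X)) , cong proj₁ (splitAt-map (Prod.map φL φL) n cl)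

app-head : ∀ X p → hd (fresh p 0 (#⁻ X)) ≡ loc p 0
app-head X p with #⁻ X | minus-nonEmpty X
... | _ | k , refl = refl

fits-fresh : ∀ X p → Fits X (fresh p 0 (#⁻ X)) (fresh p (#⁻ X) (#⁺ X))
fits-fresh X p = length-block (loc p) 0 (#⁻ X) , length-block (loc p) (#⁻ X) (#⁺ X)

-- Simulating each program by the other, jump by jump.

Path : List Edge → Label → Label → Set
Path G = Star (λ a b → (a , b) ∈ G)

edge : ∀ {G a b} → (a , b) ∈ G → Path G a b
edge m = m ◅ ε

Realised : (Label → Label) → List Edge → List Edge → Set
Realised f G = All (λ e → Path G (f (proj₁ e)) (f (proj₂ e)))

-- Every CPS jump a → b at a node is realised by a path ψ a →* ψ b of jumps of
-- the Int-interpretation (the jump of a λ into its body becomes the empty path).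
cps⇒int : ∀ {Γ t X} (d : Γ ⊢ t ∶ X) p xm xp cl h {xmC xpC clC} G →
  Fits X xm xp → FitsC Γ cl → Shifted h xm xp cl xmC xpC clC →
  ψ h ≡ hd xm → hd xm ≡ ψhead p → intEdges d p xm xp cl ⊆ G →
  Realised ψ G (cpsEdges (cps d p xmC xpC clC))
cps⇒int (ax {x} {X}) p xm xp ((cm , cp) ∷ []) h G fx (fc , tt) (refl , refl , refl) ψ-cont _ sub
  with minus-nonEmpty X
... | k , ek with cons-view xm (trans (proj₁ fx) ek) | cons-view cm (trans (proj₁ fc) ek)
... | x₀ , xs , refl | c₀ , cs , refl =
  All-resp-↭ (↭-sym (ax-cpsEdges X x p h x₀ xs c₀ cs cp xp fx fc))
    (subst₂ (Path G) (sym ψ-cont) (sym (ψ∘φ c₀)) (edge (sub′ (here refl))) ∷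
     All.map⁺ (All.tabulate λ {e} m →
       subst₂ (Path G) (sym (ψ∘φ (proj₁ e))) (sym (ψ∘φ (proj₂ e))) (edge (sub′ (there m)))))
  where
  sub′ : (x₀ , c₀) ∷ (zip xs cs ++ zip cp xp) ⊆ G
  sub′ {e} m = sub (subst (e ∈_) (sym (ax-intEdges X x p x₀ xs c₀ cs cp xp)) m)
cps⇒int oneI p xm xp [] h G (lxm , lxp) tt (refl , refl , refl) ψ-cont _ sub
  with cons-view xm lxm | cons-view xp lxp
... | x₀ , [] , refl | y₀ , [] , refl = subst₂ (Path G) (sym ψ-cont) (sym (ψ∘φ y₀)) (edge (sub (here refl))) ∷ []
cps⇒int (weak _ d) p xm xp (c ∷ cl) h G fx (_ , fcl) (refl , refl , refl) ψ-cont head-at-p sub =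
  cps⇒int d (0 ∷ p) xm xp cl h G fx fcl (refl , refl , refl) ψ-cont head-at-p sub
cps⇒int (exch {Δ = Δ} {a = a} {b = b} {Γ = Γ} d) p xm xp cl h G fx fcl (refl , refl , refl) ψ-cont head-at-p sub =
  cps⇒int d (0 ∷ p) xm xp (swapAt (length Δ) cl) h G fx (FitsC-swap Δ a b Γ cl fcl)
    (refl , refl , swapAt-map (Prod.map φL φL) (length Δ) cl) ψ-cont head-at-p sub
cps⇒int (lamI {X = X} {Y = Y} _ d) p xm xp cl h G fx fcl (refl , refl , refl) ψ-cont head-at-p sub
  with cons-view xm (trans (proj₁ fx) (proj₂ (minus-nonEmpty (X ⇒ Y))))
... | x₀ , xs , refl =
  All++ (All++ body []) (subst₂ (Path G) (sym ψ-cont) head-at-p ε ∷ [])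
  where
  body = cps⇒int d (0 ∷ p) _ _ _ (loc p 0) G (proj₁ (fits-lam X Y fx)) (proj₂ (fits-lam X Y fx) , fcl)
           (lam-shifted Y p x₀ xs xp cl) (trans (sym head-at-p) (sym (lam-head Y x₀ xs))) (trans (lam-head Y x₀ xs) head-at-p) sub
cps⇒int (appE {Γ = Γ} {Δ = Δ} {X = X} {Y = Y} fr ds dt) p xm xp cl h G fx fcl (refl , refl , refl) ψ-cont head-at-p sub
  with cons-view xm (trans (proj₁ fx) (proj₂ (minus-nonEmpty Y)))
... | y₀ , ys , refl =
  All++ (All++ fun (All++ arg [])) (subst₂ (Path G) (sym ψ-cont) head-at-p ε ∷ [])
  where
  lm = fresh p 0 (#⁻ X)
  lp = fresh p (#⁻ X) (#⁺ X)
  sub-app : ∀ {e} → e ∈ intEdges ds (0 ∷ p) ((y₀ ∷ ys) ++ lp) (xp ++ lm) _ ++ intEdges dt (1 ∷ p) lm lp _ → e ∈ G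
  sub-app {e} m = sub (subst (e ∈_) (sym (app-intEdges fr ds dt p (y₀ ∷ ys) xp cl)) m)
  fun = cps⇒int ds (0 ∷ p) _ _ _ (loc p 0) G (fits-app X Y {y₀ ∷ ys} {xp} {lm} {lp} fx (fits-fresh X p))
          (proj₂ (FitsC-split Δ Γ cl fcl)) (app-shifted-fun X (length Δ) p y₀ ys xp cl)
          (sym head-at-p) head-at-p (sub-app ∘ ∈-++⁺ˡ)
  arg = cps⇒int dt (1 ∷ p) lm lp _ _ G (fits-fresh X p) (proj₁ (FitsC-split Δ Γ cl fcl))
          (app-shifted-arg X (length Δ) p cl) (ψ∘φ (hd lm)) (app-head X p) (sub-app ∘ ∈-++⁺ʳ _)

int⇒cps : ∀ {Γ t X} (d : Γ ⊢ t ∶ X) p xm xp cl h {xmC xpC clC} G →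
  Fits X xm xp → FitsC Γ cl → Shifted h xm xp cl xmC xpC clC →
  Path G (φ (hd xm)) h → cpsEdges (cps d p xmC xpC clC) ⊆ G →
  Realised φ G (intEdges d p xm xp cl)
int⇒cps (ax {x} {X}) p xm xp ((cm , cp) ∷ []) h G fx (fc , tt) (refl , refl , refl) h-reached sub
  with minus-nonEmpty X
... | k , ek with cons-view xm (trans (proj₁ fx) ek) | cons-view cm (trans (proj₁ fc) ek)
... | x₀ , xs , refl | c₀ , cs , refl =
  subst (Realised φ G) (sym (ax-intEdges X x p x₀ xs c₀ cs cp xp))
    ((h-reached ◅◅ edge (sub′ (here refl))) ∷ All.tabulate λ m → edge (sub′ (there (∈-map⁺ φ² m))))
  where
  sub′ : (h , φ c₀) ∷ map φ² (zip xs cs ++ zip cp xp) ⊆ G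
  sub′ m = sub (∈-resp-↭ (↭-sym (ax-cpsEdges X x p h x₀ xs c₀ cs cp xp fx fc)) m)
int⇒cps oneI p xm xp [] h G (lxm , lxp) tt (refl , refl , refl) h-reached sub
  with cons-view xm lxm | cons-view xp lxp
... | x₀ , [] , refl | y₀ , [] , refl = (h-reached ◅◅ edge (sub (here refl))) ∷ []
int⇒cps (weak _ d) p xm xp (c ∷ cl) h G fx (_ , fcl) (refl , refl , refl) h-reached sub =
  int⇒cps d (0 ∷ p) xm xp cl h G fx fcl (refl , refl , refl) h-reached sub
int⇒cps (exch {Δ = Δ} {a = a} {b = b} {Γ = Γ} d) p xm xp cl h G fx fcl (refl , refl , refl) h-reached sub =
  int⇒cps d (0 ∷ p) xm xp (swapAt (length Δ) cl) h G fx (FitsC-swap Δ a b Γ cl fcl)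
    (refl , refl , swapAt-map (Prod.map φL φL) (length Δ) cl) h-reached sub
int⇒cps (lamI {X = X} {Y = Y} _ d) p xm xp cl h G fx fcl (refl , refl , refl) h-reached sub
  with cons-view xm (trans (proj₁ fx) (proj₂ (minus-nonEmpty (X ⇒ Y))))
... | x₀ , xs , refl =
  int⇒cps d (0 ∷ p) _ _ _ (loc p 0) G (proj₁ (fits-lam X Y fx)) (proj₂ (fits-lam X Y fx) , fcl)
    (lam-shifted Y p x₀ xs xp cl)
    (subst (λ z → Path G (φ z) (loc p 0)) (sym (lam-head Y x₀ xs)) (h-reached ◅◅ edge (sub (∈-++⁺ʳ _ (here refl)))))
    (λ m → sub (∈-++⁺ˡ (∈-++⁺ˡ m)))
int⇒cps (appE {Γ = Γ} {Δ = Δ} {X = X} {Y = Y} fr ds dt) p xm xp cl h G fx fcl (refl , refl , refl) h-reached sub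
  with cons-view xm (trans (proj₁ fx) (proj₂ (minus-nonEmpty Y)))
... | y₀ , ys , refl =
  subst (Realised φ G) (sym (app-intEdges fr ds dt p (y₀ ∷ ys) xp cl)) (All++ fun arg)
  where
  lm = fresh p 0 (#⁻ X)
  lp = fresh p (#⁻ X) (#⁺ X)
  cpsFun = cps ds (0 ∷ p) (loc p 0 ∷ (φL ys ++ fresh p (1 + #⁻ X) (#⁺ X))) (φL xp ++ fresh p 1 (#⁻ X))
                          (proj₂ (splitAt (length Δ) (φC cl)))
  fun = int⇒cps ds (0 ∷ p) _ _ _ (loc p 0) G (fits-app X Y {y₀ ∷ ys} {xp} {lm} {lp} fx (fits-fresh X p))
          (proj₂ (FitsC-split Δ Γ cl fcl)) (app-shifted-fun X (length Δ) p y₀ ys xp cl)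
          (h-reached ◅◅ edge (sub (∈-++⁺ʳ _ (here refl)))) (λ m → sub (∈-++⁺ˡ (∈-++⁺ˡ m)))
  arg = int⇒cps dt (1 ∷ p) lm lp _ _ G (fits-fresh X p) (proj₁ (FitsC-split Δ Γ cl fcl))
          (app-shifted-arg X (length Δ) p cl) ε (λ m → sub (∈-++⁺ˡ (∈-++⁺ʳ (cpsEdges cpsFun) (∈-++⁺ˡ m))))

-- Labels generated in a subtree: all labels generated below address p have
-- the form loc q n with p a suffix of q.

data _≼_ (p : Addr) : Addr → Set where
  ≼-refl : p ≼ p
  ≼-step : ∀ {c q} → p ≼ q → p ≼ (c ∷ q)

_≼?_ : ∀ p q → Dec (p ≼ q)
p ≼? [] with ≡-dec ℕ._≟_ p []
... | yes refl = yes ≼-refl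
... | no p≢ = no λ { ≼-refl → p≢ refl }
p ≼? (c ∷ q) with ≡-dec ℕ._≟_ p (c ∷ q)
... | yes refl = yes ≼-refl
... | no p≢ with p ≼? q
... | yes p≼q = yes (≼-step p≼q)
... | no p⋠q = no λ { ≼-refl → p≢ refl ; (≼-step p≼q) → p⋠q p≼q }

≼-length : ∀ {p q} → p ≼ q → length p ≤ length q
≼-length ≼-refl = ≤-refl
≼-length (≼-step p≼q) = m≤n⇒m≤1+n (≼-length p≼q)

≼-parent : ∀ {c p q} → (c ∷ p) ≼ q → p ≼ q
≼-parent ≼-refl = ≼-step ≼-refl
≼-parent (≼-step s) = ≼-step (≼-parent s)

≼-depth : ∀ {u v w} → u ≼ w → v ≼ w → length u ≡ length v → u ≡ v
≼-depth ≼-refl ≼-refl _ = refl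
≼-depth ≼-refl (≼-step s) eq = ⊥-elim (<-irrefl (sym eq) (s≤s (≼-length s)))
≼-depth (≼-step s) ≼-refl eq = ⊥-elim (<-irrefl eq (s≤s (≼-length s)))
≼-depth (≼-step s) (≼-step t) eq = ≼-depth s t eq

[]≼ : ∀ q → [] ≼ q
[]≼ [] = ≼-refl
[]≼ (_ ∷ q) = ≼-step ([]≼ q)

local : Addr → Label → ℕ
local p (top _) = 0
local p (loc q _) with p ≼? q
... | yes _ = 1
... | no _ = 0

local-child : ∀ c p a → local (c ∷ p) a ≤ local p a
local-child c p (top _) = z≤n
local-child c p (loc q _) with (c ∷ p) ≼? q | p ≼? q
... | yes _ | yes _ = ≤-refl
... | yes s | no p⋠q = ⊥-elim (p⋠q (≼-parent s))
... | no _ | _ = z≤n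

local-root : ∀ q n → local [] (loc q n) ≡ 1
local-root q n with [] ≼? q
... | yes _ = refl
... | no ⋠ = ⊥-elim (⋠ ([]≼ q))

local-fresh : ∀ p n a → occ a (fresh p 0 n) + (local (0 ∷ p) a + local (1 ∷ p) a) ≤ local p a
local-fresh p n (top m) = ≤-reflexive (cong (_+ 0) (occ-∉ (fresh p 0 n) (block-∉ (loc p) 0 n λ _ ())))
local-fresh p n (loc r k) with ≡-dec ℕ._≟_ r p
... | yes refl = begin
  occ (loc r k) (fresh r 0 n) + (local (0 ∷ r) (loc r k) + local (1 ∷ r) (loc r k))
    ≡⟨ cong (occ (loc r k) (fresh r 0 n) +_) (cong₂ _+_ (not-below 0) (not-below 1)) ⟩
  occ (loc r k) (fresh r 0 n) + 0 ≡⟨ +-identityʳ _ ⟩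
  occ (loc r k) (fresh r 0 n) ≤⟨ Unique⇒occ≤1 (loc r k) (block-unique (λ { refl → refl }) 0 n) ⟩
  1 ≡⟨ at-p ⟨
  local r (loc r k) ∎
  where
  open ≤-Reasoning
  not-below : ∀ c → local (c ∷ r) (loc r k) ≡ 0
  not-below c with (c ∷ r) ≼? r
  ... | yes s = ⊥-elim (<-irrefl refl (≼-length s))
  ... | no _ = refl
  at-p : local r (loc r k) ≡ 1
  at-p with r ≼? r
  ... | yes _ = refl
  ... | no r⋠r = ⊥-elim (r⋠r ≼-refl)
... | no r≢p = begin
  occ (loc r k) (fresh p 0 n) + (local (0 ∷ p) (loc r k) + local (1 ∷ p) (loc r k))
    ≡⟨ cong (_+ _) (occ-∉ (fresh p 0 n) (block-∉ (loc p) 0 n λ { _ refl → r≢p refl })) ⟩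
  local (0 ∷ p) (loc r k) + local (1 ∷ p) (loc r k) ≤⟨ children ⟩
  local p (loc r k) ∎
  where
  open ≤-Reasoning
  children : local (0 ∷ p) (loc r k) + local (1 ∷ p) (loc r k) ≤ local p (loc r k)
  children with (0 ∷ p) ≼? r | (1 ∷ p) ≼? r | p ≼? r
  ... | yes s₀ | yes s₁ | _ with ≼-depth s₀ s₁ refl
  ...   | ()
  children | yes _ | no _ | yes _ = ≤-refl
  children | yes s₀ | no _ | no p⋠r = ⊥-elim (p⋠r (≼-parent s₀))
  children | no _ | yes _ | yes _ = ≤-refl
  children | no _ | yes s₁ | no p⋠r = ⊥-elim (p⋠r (≼-parent s₁))
  children | no _ | no _ | _ = z≤n

ctxEntries : CLabs → List Label
ctxEntries = concatMap proj₂

ctxEntries-swap : ∀ n cl → ctxEntries (swapAt n cl) ↭ ctxEntries cl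
ctxEntries-swap zero [] = ↭-refl
ctxEntries-swap zero (c ∷ []) = ↭-refl
ctxEntries-swap zero (c ∷ c′ ∷ cl) = shifts (proj₂ c′) (proj₂ c)
ctxEntries-swap (suc n) [] = ↭-refl
ctxEntries-swap (suc n) (c ∷ cl) = ↭-++⁺ˡ (proj₂ c) (ctxEntries-swap n cl)

ctxEntries-split : ∀ n cl → ctxEntries (proj₁ (splitAt n cl)) ++ ctxEntries (proj₂ (splitAt n cl)) ≡ ctxEntries cl
ctxEntries-split n cl = trans (sym (concatMap-++ proj₂ (proj₁ (splitAt n cl)) _))
  (cong ctxEntries (splitAt-join n cl))

sources : List Edge → List Label
sources = map proj₁

occ-sources-++ : ∀ a E F → occ a (sources (E ++ F)) ≡ occ a (sources E) + occ a (sources F)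
occ-sources-++ a E F = trans (cong (occ a) (map-++ proj₁ E F)) (occ-++ a (sources E) (sources F))

occ-sources-++[] : ∀ a E → occ a (sources (E ++ [])) ≡ occ a (sources E)
occ-sources-++[] a E = cong (occ a ∘ sources) (++-identityʳ E)

fits-lam-cps : ∀ X Y {h xs xp} h′ → Fits (X ⇒ Y) (h ∷ xs) xp →
  Fits Y (h′ ∷ proj₁ (splitAt (#⁻ Y ∸ 1) xs)) (proj₁ (splitAt (#⁺ Y) xp)) ×
  Fits X (proj₂ (splitAt (#⁺ Y) xp)) (proj₂ (splitAt (#⁻ Y ∸ 1) xs))
fits-lam-cps X Y {h} {xs} h′ fx with fits-lam X Y {h′ ∷ xs} fx
... | fy , fx′ rewrite splitAt-cons h′ xs (proj₂ (minus-nonEmpty Y)) = fy , fx′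

-- Bounds at a node at address p whose CPS translation generates the labels
-- fresh p 0 n and whose own λ is labelled with the head h of its X⁻ block.
bound-node : ∀ p n a S h rest →
  S ≤ occ a (fresh p 0 n ++ rest) + (local (0 ∷ p) a + local (1 ∷ p) a) →
  S + occ a [ h ] ≤ occ a (h ∷ rest) + local p a
bound-node p n a S h rest S≤ = begin
  S + occ a [ h ]
    ≤⟨ +-monoˡ-≤ _ S≤ ⟩
  occ a (fresh p 0 n ++ rest) + (l₀ + l₁) + occ a [ h ]
    ≡⟨ cong (λ z → z + (l₀ + l₁) + occ a [ h ]) (occ-++ a (fresh p 0 n) rest) ⟩
  occ a (fresh p 0 n) + occ a rest + (l₀ + l₁) + occ a [ h ]
    ≡⟨ rearrange (occ a (fresh p 0 n)) (occ a rest) (l₀ + l₁) (occ a [ h ]) ⟩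
  (occ a [ h ] + occ a rest) + (occ a (fresh p 0 n) + (l₀ + l₁))
    ≤⟨ +-monoʳ-≤ _ (local-fresh p n a) ⟩
  (occ a [ h ] + occ a rest) + local p a
    ≡⟨ cong (_+ local p a) (occ-cons a h rest) ⟨
  occ a (h ∷ rest) + local p a ∎
  where
  open ≤-Reasoning
  l₀ = local (0 ∷ p) a
  l₁ = local (1 ∷ p) a
  rearrange : ∀ f r l h → f + r + l + h ≡ (h + r) + (f + l)
  rearrange = solve-∀

bound-child : ∀ p a {S} E E′ → occ a E′ ≤ occ a E → S ≤ occ a E′ + local (0 ∷ p) a → S ≤ occ a E + local p a
bound-child p a E E′ E′≤E S≤ = ≤-trans S≤ (+-mono-≤ E′≤E (local-child 0 p a))

lam-entries : ∀ n p (xs E : List Label) →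
  (loc p 0 ∷ proj₁ (splitAt n xs)) ++ (proj₂ (splitAt n xs) ++ E) ≡ fresh p 0 1 ++ (xs ++ E)
lam-entries n p xs E =
  cong (loc p 0 ∷_) (trans (sym (++-assoc (proj₁ (splitAt n xs)) _ E)) (cong (_++ E) (splitAt-join n xs)))

app-entries : ∀ X p n ys cl →
  ((loc p 0 ∷ (ys ++ fresh p (1 + #⁻ X) (#⁺ X))) ++ ctxEntries (proj₂ (splitAt n cl))) ++
    (fresh p 1 (#⁻ X) ++ ctxEntries (proj₁ (splitAt n cl)))
  ↭ fresh p 0 (1 + (#⁻ X + #⁺ X)) ++ (ys ++ ctxEntries cl)
app-entries X p n ys cl = begin
  loc p 0 ∷ (((ys ++ lp) ++ EΓ) ++ (lm ++ EΔ))
    ↭⟨ ↭-prep (loc p 0) (begin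
      ((ys ++ lp) ++ EΓ) ++ (lm ++ EΔ) ↭⟨ ↭-++-comm ((ys ++ lp) ++ EΓ) (lm ++ EΔ) ⟩
      (lm ++ EΔ) ++ ((ys ++ lp) ++ EΓ) ↭⟨ ↭-interchange lm EΔ (ys ++ lp) EΓ ⟩
      (lm ++ (ys ++ lp)) ++ (EΔ ++ EΓ) ↭⟨ ↭-++⁺ʳ (EΔ ++ EΓ) (↭-++⁺ˡ lm (↭-++-comm ys lp)) ⟩
      (lm ++ (lp ++ ys)) ++ (EΔ ++ EΓ) ≡⟨ cong (_++ (EΔ ++ EΓ)) (++-assoc lm lp ys) ⟨
      ((lm ++ lp) ++ ys) ++ (EΔ ++ EΓ) ≡⟨ ++-assoc (lm ++ lp) ys (EΔ ++ EΓ) ⟩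
      (lm ++ lp) ++ (ys ++ (EΔ ++ EΓ)) ∎) ⟩
  loc p 0 ∷ ((lm ++ lp) ++ (ys ++ (EΔ ++ EΓ)))
    ≡⟨ cong₂ (λ g E → g ++ (ys ++ E)) (sym generated) (ctxEntries-split n cl) ⟩
  fresh p 0 (1 + (#⁻ X + #⁺ X)) ++ (ys ++ ctxEntries cl) ∎
  where
  open PermutationReasoning
  lm = fresh p 1 (#⁻ X)
  lp = fresh p (1 + #⁻ X) (#⁺ X)
  EΔ = ctxEntries (proj₁ (splitAt n cl))
  EΓ = ctxEntries (proj₂ (splitAt n cl))
  generated : fresh p 0 (1 + (#⁻ X + #⁺ X)) ≡ loc p 0 ∷ (lm ++ lp)
  generated = trans (block-split (loc p) 0 1 (#⁻ X + #⁺ X)) (cong (loc p 0 ∷_) (block-split (loc p) 1 (#⁻ X) (#⁺ X)))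

sources-bound : ∀ {Γ t X} (d : Γ ⊢ t ∶ X) p xm xp cl → Fits X xm xp → FitsC Γ cl →
  ∀ a → occ a (sources (cpsEdges (cps d p xm xp cl))) ≤ occ a (xm ++ ctxEntries cl) + local p a
sources-bound (ax {x} {X}) p xm xp ((cm , cp) ∷ []) fx (fc , tt) a = begin
  occ a (sources (cpsEdges (eta p (lvar (src x)) (ol X cm cp) (ol X xm xp))))
    ≡⟨ cong (occ a ∘ sources) (proj₂ (eta-cps p (src x) (ol-shape X cm cp xm xp))) ⟩
  occ a (sources (etaEdges (ol X cm cp) (ol X xm xp)))
    ≡⟨ occ-↭ a (↭-map⁺ proj₁ (ol-etaEdges X cm cp xm xp fc fx)) ⟩
  occ a (sources (zip xm cm ++ zip cp xp))
    ≡⟨ cong (occ a) (trans (map-++ proj₁ (zip xm cm) (zip cp xp))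
         (cong₂ _++_ (map-proj₁-zip xm cm (trans (proj₁ fx) (sym (proj₁ fc))))
                     (trans (map-proj₁-zip cp xp (trans (proj₂ fc) (sym (proj₂ fx)))) (sym (++-identityʳ cp))))) ⟩
  occ a (xm ++ cp ++ [])
    ≤⟨ m≤m+n _ _ ⟩
  occ a (xm ++ cp ++ []) + local p a ∎
  where open ≤-Reasoning
sources-bound oneI p xm xp [] (lxm , _) tt a with cons-view xm lxm
... | x₀ , [] , refl = m≤m+n _ _
sources-bound (weak _ d) p xm xp (c ∷ cl) fx (_ , fcl) a =
  bound-child p a (xm ++ ctxEntries (c ∷ cl)) (xm ++ ctxEntries cl) (occ-insert a xm (proj₂ c) (ctxEntries cl))
    (sources-bound d (0 ∷ p) xm xp cl fx fcl a)
sources-bound (exch {Δ = Δ} {a = u} {b = v} {Γ = Γ} d) p xm xp cl fx fcl a =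
  bound-child p a (xm ++ ctxEntries cl) (xm ++ ctxEntries (swapAt (length Δ) cl))
    (≤-reflexive (occ-↭ a (↭-++⁺ˡ xm (ctxEntries-swap (length Δ) cl))))
    (sources-bound d (0 ∷ p) xm xp (swapAt (length Δ) cl) fx (FitsC-swap Δ u v Γ cl fcl) a)
sources-bound (lamI {X = X} {Y = Y} _ d) p xm xp cl fx fcl a
  with cons-view xm (trans (proj₁ fx) (proj₂ (minus-nonEmpty (X ⇒ Y))))
... | h , xs , refl =
  ≤-trans (≤-reflexive (occ-sources-++ a (cpsEdges body ++ []) ((h , loc p 0) ∷ [])))
          (bound-node p 1 a (occ a (sources (cpsEdges body ++ []))) h (xs ++ ctxEntries cl) (begin
    occ a (sources (cpsEdges body ++ []))
      ≡⟨ occ-sources-++[] a (cpsEdges body) ⟩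
    occ a (sources (cpsEdges body))
      ≤⟨ sources-bound d (0 ∷ p) (loc p 0 ∷ B₁) (proj₁ (splitAt (#⁺ Y) xp)) ((proj₂ (splitAt (#⁺ Y) xp) , B₂) ∷ cl)
                       (proj₁ fits) (proj₂ fits , fcl) a ⟩
    occ a ((loc p 0 ∷ B₁) ++ (B₂ ++ ctxEntries cl)) + l₀
      ≡⟨ cong (λ E → occ a E + l₀) (lam-entries (#⁻ Y ∸ 1) p xs (ctxEntries cl)) ⟩
    occ a (fresh p 0 1 ++ (xs ++ ctxEntries cl)) + l₀
      ≤⟨ +-monoʳ-≤ (occ a (fresh p 0 1 ++ (xs ++ ctxEntries cl))) (m≤m+n l₀ (local (1 ∷ p) a)) ⟩
    occ a (fresh p 0 1 ++ (xs ++ ctxEntries cl)) + (l₀ + local (1 ∷ p) a) ∎))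
  where
  open ≤-Reasoning
  B₁ = proj₁ (splitAt (#⁻ Y ∸ 1) xs)
  B₂ = proj₂ (splitAt (#⁻ Y ∸ 1) xs)
  l₀ = local (0 ∷ p) a
  fits = fits-lam-cps X Y {h} {xs} {xp} (loc p 0) fx
  body = cps d (0 ∷ p) (loc p 0 ∷ B₁) (proj₁ (splitAt (#⁺ Y) xp)) ((proj₂ (splitAt (#⁺ Y) xp) , B₂) ∷ cl)
sources-bound (appE {Γ = Γ} {Δ = Δ} {X = X} {Y = Y} _ ds dt) p xm xp cl fx fcl a
  with cons-view xm (trans (proj₁ fx) (proj₂ (minus-nonEmpty Y)))
... | h , ys , refl =
  ≤-trans (≤-reflexive (occ-sources-++ a (cpsEdges fun ++ (cpsEdges arg ++ [])) ((h , loc p 0) ∷ [])))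
          (bound-node p (1 + (#⁻ X + #⁺ X)) a (occ a (sources (cpsEdges fun ++ (cpsEdges arg ++ [])))) h (ys ++ ctxEntries cl) (begin
    occ a (sources (cpsEdges fun ++ (cpsEdges arg ++ [])))
      ≡⟨ trans (occ-sources-++ a (cpsEdges fun) _) (cong (occ a (sources (cpsEdges fun)) +_) (occ-sources-++[] a (cpsEdges arg))) ⟩
    occ a (sources (cpsEdges fun)) + occ a (sources (cpsEdges arg))
      ≤⟨ +-mono-≤ (sources-bound ds (0 ∷ p) (loc p 0 ∷ (ys ++ lp)) (xp ++ lm) clΓ fits-fun (proj₂ (FitsC-split Δ Γ cl fcl)) a)
                  (sources-bound dt (1 ∷ p) lm lp clΔ fits-arg (proj₁ (FitsC-split Δ Γ cl fcl)) a) ⟩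
    (occ a entries-fun + l₀) + (occ a entries-arg + l₁)
      ≡⟨ +-interchange (occ a entries-fun) l₀ (occ a entries-arg) l₁ ⟩
    (occ a entries-fun + occ a entries-arg) + (l₀ + l₁)
      ≡⟨ cong (_+ (l₀ + l₁)) (trans (sym (occ-++ a entries-fun entries-arg)) (occ-↭ a (app-entries X p (length Δ) ys cl))) ⟩
    occ a (fresh p 0 (1 + (#⁻ X + #⁺ X)) ++ (ys ++ ctxEntries cl)) + (l₀ + l₁) ∎))
  where
  open ≤-Reasoning
  lm = fresh p 1 (#⁻ X)
  lp = fresh p (1 + #⁻ X) (#⁺ X)
  clΔ = proj₁ (splitAt (length Δ) cl)
  clΓ = proj₂ (splitAt (length Δ) cl)
  entries-fun = (loc p 0 ∷ (ys ++ lp)) ++ ctxEntries clΓ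
  entries-arg = lm ++ ctxEntries clΔ
  fun = cps ds (0 ∷ p) (loc p 0 ∷ (ys ++ lp)) (xp ++ lm) clΓ
  arg = cps dt (1 ∷ p) lm lp clΔ
  fits-arg : Fits X lm lp
  fits-arg = length-block (loc p) 1 (#⁻ X) , length-block (loc p) (1 + #⁻ X) (#⁺ X)
  fits-fun : Fits (X ⇒ Y) (loc p 0 ∷ (ys ++ lp)) (xp ++ lm)
  fits-fun = fits-app X Y {loc p 0 ∷ ys} {xp} {lm} {lp} fx fits-arg
  l₀ = local (0 ∷ p) a
  l₁ = local (1 ∷ p) a

UnitJump : Def → Set
UnitJump (jump f x g e) = ((x , vunit) ∷ []) ⊢ e ⇓ vunit
UnitJump (branch _ _ _ _ _ _ _ _ _) = ⊥

unitJump-edge : ∀ {ds f x g e} → jump f x g e ∈ ds → (f , g) ∈ defEdges ds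
unitJump-edge {jump _ _ _ _ ∷ ds} (here refl) = here refl
unitJump-edge {jump _ _ _ _ ∷ ds} (there m) = there (unitJump-edge m)
unitJump-edge {branch _ _ _ _ _ _ _ _ _ ∷ ds} (there m) = unitJump-edge m

edge-unitJump : ∀ ds {f g} → (f , g) ∈ defEdges ds → Σ Var λ x → Σ Exp λ e → jump f x g e ∈ ds
edge-unitJump (jump _ x _ e ∷ ds) (here refl) = x , e , here refl
edge-unitJump (jump _ _ _ _ ∷ ds) (there m) = Prod.map₂ (Prod.map₂ there) (edge-unitJump ds m)
edge-unitJump (branch _ _ _ _ _ _ _ _ _ ∷ ds) m = Prod.map₂ (Prod.map₂ there) (edge-unitJump ds m)

trace⇒path : ∀ {ins ds outs} → All UnitJump ds → ∀ {a b} →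
  Trace (prog ins ds outs) a b → Path (defEdges ds) (proj₁ a) (proj₁ b)
trace⇒path {ds = ds} units = gmap proj₁ step
  where
  step : ∀ {a b} → Step (prog _ ds _) a b → (proj₁ a , proj₁ b) ∈ defEdges ds
  step (s-jump m _) = unitJump-edge m
  step (s-inl m _ _) = ⊥-elim (All.lookup units m)
  step (s-inr m _ _) = ⊥-elim (All.lookup units m)

path⇒trace : ∀ {ins ds outs} → All UnitJump ds → ∀ {a b} →
  Path (defEdges ds) a b → Trace (prog ins ds outs) (a , vunit) (b , vunit)
path⇒trace {ds = ds} units = gmap (_, vunit) step
  where
  step : ∀ {a b} → (a , b) ∈ defEdges ds → Step (prog _ ds _) (a , vunit) (b , vunit)
  step m with edge-unitJump ds m
  ... | _ , _ , m′ = s-jump m′ (All.lookup units m′)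

defEdges-erased : ∀ G → defEdges (map erasedJump G) ≡ G
defEdges-erased [] = refl
defEdges-erased (e ∷ G) = cong (e ∷_) (defEdges-erased G)

erased-unitJumps : ∀ G → All UnitJump (map erasedJump G)
erased-unitJumps G = All.map⁺ (All.tabulate λ _ → e-unit)

fwds-unitJumps : ∀ xs ys → All UnitJump (fwds xs ys)
fwds-unitJumps (x ∷ xs) (y ∷ ys) = e-var refl ∷ fwds-unitJumps xs ys
fwds-unitJumps [] ys = []
fwds-unitJumps (x ∷ xs) [] = []

int-unitJumps : ∀ {Γ t X} (d : Γ ⊢ t ∶ X) p xm xp cl → All UnitJump (intD d p xm xp cl)
int-unitJumps ax p xm xp cl = All++ (fwds-unitJumps xm (proj₁ (headC cl))) (fwds-unitJumps (proj₂ (headC cl)) xp)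
int-unitJumps oneI p xm xp cl = e-unit ∷ []
int-unitJumps (weak _ d) p xm xp cl = int-unitJumps d _ _ _ _
int-unitJumps (exch d) p xm xp cl = int-unitJumps d _ _ _ _
int-unitJumps (lamI _ d) p xm xp cl = int-unitJumps d _ _ _ _
int-unitJumps (appE _ ds dt) p xm xp cl = All++ (int-unitJumps ds _ _ _ _) (int-unitJumps dt _ _ _ _)

realise-path : ∀ {f G E} → Realised f G E → ∀ {a b} → Path E a b → Path G (f a) (f b)
realise-path r ε = ε
realise-path r (m ◅ path) = All.lookup r m ◅◅ realise-path r path

tops-φ : ∀ s n → φL (tops s n) ≡ tops s n
tops-φ s n = sym (map-∘ (upTo n))

ctxLabs-φ : ∀ n Γ → φC (ctxLabs n Γ) ≡ ctxLabs n Γ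
ctxLabs-φ n [] = refl
ctxLabs-φ n ((_ , X) ∷ Γ) = cong₂ _∷_ (cong₂ _,_ (tops-φ n (#⁻ X)) (tops-φ (n + #⁻ X) (#⁺ X))) (ctxLabs-φ _ Γ)

fits-ctxLabs : ∀ n Γ → FitsC Γ (ctxLabs n Γ)
fits-ctxLabs n [] = tt
fits-ctxLabs n ((_ , X) ∷ Γ) = (length-block top n (#⁻ X) , length-block top (n + #⁻ X) (#⁺ X)) , fits-ctxLabs _ Γ

tops-head : ∀ n k → n ≡ suc k → tops 0 n ≡ top 0 ∷ φL (tl (tops 0 n))
tops-head _ k refl = cong (top 0 ∷_) (cong tl (sym (tops-φ 0 (suc k))))

top-shifted : ∀ X Γ → Shifted (top 0) (topXm X) (topXp X) (topCl X Γ) (topXm X) (topXp X) (topCl X Γ)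
top-shifted X Γ = tops-head (#⁻ X) _ (proj₂ (minus-nonEmpty X)) , sym (tops-φ (#⁻ X) (#⁺ X)) , sym (ctxLabs-φ _ Γ)

ctxSize : Ctx → ℕ
ctxSize [] = 0
ctxSize ((_ , X) ∷ Γ) = #⁻ X + #⁺ X + ctxSize Γ

ctxLabs-tops : ∀ n Γ → concatMap (λ c → proj₁ c ++ proj₂ c) (ctxLabs n Γ) ≡ tops n (ctxSize Γ)
ctxLabs-tops n [] = refl
ctxLabs-tops n ((_ , X) ∷ Γ) = begin
  (tops n m ++ tops (n + m) q) ++ concatMap (λ c → proj₁ c ++ proj₂ c) (ctxLabs (n + m + q) Γ)
    ≡⟨ cong₂ _++_ (sym (block-split top n m q)) (ctxLabs-tops (n + m + q) Γ) ⟩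
  tops n (m + q) ++ tops (n + m + q) (ctxSize Γ)
    ≡⟨ cong (λ s → tops n (m + q) ++ tops s (ctxSize Γ)) (+-assoc n m q) ⟩
  tops n (m + q) ++ tops (n + (m + q)) (ctxSize Γ)
    ≡⟨ block-split top n (m + q) (ctxSize Γ) ⟨
  tops n (m + q + ctxSize Γ) ∎
  where
  open ≡-Reasoning
  m = #⁻ X
  q = #⁺ X

concatMap-interleave : ∀ {A B : Set} (f g : A → List B) xs →
  concatMap (λ c → f c ++ g c) xs ↭ concatMap f xs ++ concatMap g xs
concatMap-interleave f g [] = ↭-refl
concatMap-interleave f g (c ∷ xs) = begin
  (f c ++ g c) ++ concatMap (λ c → f c ++ g c) xs  ≡⟨ ++-assoc (f c) (g c) _ ⟩
  f c ++ (g c ++ concatMap (λ c → f c ++ g c) xs)  ↭⟨ ↭-++⁺ˡ (f c) (↭-++⁺ˡ (g c) (concatMap-interleave f g xs)) ⟩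
  f c ++ (g c ++ (concatMap f xs ++ concatMap g xs)) ↭⟨ ↭-++⁺ˡ (f c) (shifts (g c) (concatMap f xs)) ⟩
  f c ++ (concatMap f xs ++ (g c ++ concatMap g xs)) ≡⟨ ++-assoc (f c) (concatMap f xs) _ ⟨
  (f c ++ concatMap f xs) ++ (g c ++ concatMap g xs) ∎
  where open PermutationReasoning

interface-↭ : ∀ X Γ → entriesOf X Γ ++ exitsOf X Γ ↭ tops 0 (#⁻ X + #⁺ X + ctxSize Γ)
interface-↭ X Γ = begin
  (topXm X ++ ctxEntries cl) ++ (topXp X ++ concatMap proj₁ cl)
    ↭⟨ ↭-interchange (topXm X) (ctxEntries cl) (topXp X) (concatMap proj₁ cl) ⟩
  (topXm X ++ topXp X) ++ (ctxEntries cl ++ concatMap proj₁ cl)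
    ↭⟨ ↭-++⁺ˡ (topXm X ++ topXp X) (↭-++-comm (ctxEntries cl) (concatMap proj₁ cl)) ⟩
  (topXm X ++ topXp X) ++ (concatMap proj₁ cl ++ ctxEntries cl)
    ↭⟨ ↭-++⁺ˡ (topXm X ++ topXp X) (↭-sym (concatMap-interleave proj₁ proj₂ cl)) ⟩
  (topXm X ++ topXp X) ++ concatMap (λ c → proj₁ c ++ proj₂ c) cl
    ≡⟨ cong₂ _++_ (sym (block-split top 0 (#⁻ X) (#⁺ X))) (ctxLabs-tops (#⁻ X + #⁺ X) Γ) ⟩
  tops 0 (#⁻ X + #⁺ X) ++ tops (#⁻ X + #⁺ X) (ctxSize Γ)
    ≡⟨ block-split top 0 (#⁻ X + #⁺ X) (ctxSize Γ) ⟨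
  tops 0 (#⁻ X + #⁺ X + ctxSize Γ) ∎
  where
  open PermutationReasoning
  cl = topCl X Γ

interface-occ≤1 : ∀ X Γ a → occ a (entriesOf X Γ) + occ a (exitsOf X Γ) ≤ 1
interface-occ≤1 X Γ a = begin
  occ a (entriesOf X Γ) + occ a (exitsOf X Γ) ≡⟨ occ-++ a (entriesOf X Γ) _ ⟨
  occ a (entriesOf X Γ ++ exitsOf X Γ)        ≡⟨ occ-↭ a (interface-↭ X Γ) ⟩
  occ a (tops 0 (#⁻ X + #⁺ X + ctxSize Γ))
    ≤⟨ Unique⇒occ≤1 a (block-unique {top} (λ { refl → refl }) 0 (#⁻ X + #⁺ X + ctxSize Γ)) ⟩
  1 ∎
  where open ≤-Reasoning

interface-top : ∀ X Γ {a} → a ∈ entriesOf X Γ ++ exitsOf X Γ → Σ ℕ λ n → a ≡ top n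
interface-top X Γ m with ∈-map⁻ _ (∈-resp-↭ (interface-↭ X Γ) m)
... | i , _ , eq = i , eq

ctx-units : ∀ Γ → All (_≡ unit) (minusC Γ) × All (_≡ unit) (plusC Γ)
ctx-units [] = [] , []
ctx-units ((_ , X) ∷ Γ) = Prod.map (All++ (minus-units X)) (All++ (plus-units X)) (ctx-units Γ)

length-ctxBlocks : ∀ Γ cl → FitsC Γ cl →
  length (concatMap proj₁ cl) ≡ length (minusC Γ) × length (ctxEntries cl) ≡ length (plusC Γ)
length-ctxBlocks [] [] tt = refl , refl
length-ctxBlocks ((_ , X) ∷ Γ) ((m , q) ∷ cl) ((lm , lq) , fits) with length-ctxBlocks Γ cl fits
... | l₁ , l₂ = trans (length-++ m) (trans (cong₂ _+_ lm l₁) (sym (length-++ (minus X)))) ,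
                trans (length-++ q) (trans (cong₂ _+_ lq l₂) (sym (length-++ (plus X))))

map-const-unit : ∀ (xs : List Label) {As} → length xs ≡ length As → All (_≡ unit) As → map (λ _ → unit) xs ≡ As
map-const-unit [] {[]} _ [] = refl
map-const-unit (x ∷ xs) {_ ∷ As} eq (refl ∷ units) = cong (unit ∷_) (map-const-unit xs (suc-injective eq) units)

nth-∈ : ∀ {A : Set} (xs : List A) i {x} → nth xs i ≡ just x → x ∈ xs
nth-∈ (y ∷ xs) zero refl = here refl
nth-∈ (y ∷ xs) (suc i) eq = there (nth-∈ xs i eq)

unit-value : ∀ {v A} → A ≡ unit → ⊢ᵥ v ∶ A → v ≡ vunit
unit-value refl v-unit = refl

module Root {Γ t X} (d : Γ ⊢ t ∶ X) where

  cpsTerm : LTerm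
  cpsTerm = cps d [] (topXm X) (topXp X) (topCl X Γ)

  cpsJumps intJumps : List Edge
  cpsJumps = cpsEdges cpsTerm
  intJumps = intEdges d [] (topXm X) (topXp X) (topCl X Γ)

  fits : Fits X (topXm X) (topXp X)
  fits = length-block top 0 (#⁻ X) , length-block top (#⁻ X) (#⁺ X)

  fitsC : FitsC Γ (topCl X Γ)
  fitsC = fits-ctxLabs (#⁻ X + #⁺ X) Γ

  defunctionalised : DefunErases cpsTerm
  defunctionalised = proj₂ (pure-defun (cps-pure d [] (topXm X) (topXp X) (topCl X Γ)))

  program : Prog
  program = prog (entriesOf X Γ) (proj₁ defunctionalised) (exitsOf X Γ)

  cpsDefun-program : CpsDefun d ≡ just program
  cpsDefun-program = cong (_>>= λ ds → just (prog (entriesOf X Γ) ds (exitsOf X Γ))) (proj₁ (proj₂ defunctionalised))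

  erasedProgram : Prog
  erasedProgram = prog (entriesOf X Γ) (map erasedJump cpsJumps) (exitsOf X Γ)

  erased : Erase program ≡ erasedProgram
  erased = cong (λ ds → prog (entriesOf X Γ) ds (exitsOf X Γ)) (proj₂ (proj₂ defunctionalised))

  sources-occ≤1 : ∀ a → occ a (sources cpsJumps) ≤ 1
  sources-occ≤1 (top n) = begin
    occ (top n) (sources cpsJumps)             ≤⟨ sources-bound d [] _ _ _ fits fitsC (top n) ⟩
    occ (top n) (entriesOf X Γ) + 0           ≤⟨ +-monoʳ-≤ _ z≤n ⟩
    occ (top n) (entriesOf X Γ) + occ (top n) (exitsOf X Γ) ≤⟨ interface-occ≤1 X Γ (top n) ⟩
    1 ∎
    where open ≤-Reasoning
  sources-occ≤1 (loc q n) = begin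
    occ (loc q n) (sources cpsJumps)                    ≤⟨ sources-bound d [] _ _ _ fits fitsC (loc q n) ⟩
    occ (loc q n) (entriesOf X Γ) + local [] (loc q n) ≡⟨ cong₂ _+_ (occ-∉ (entriesOf X Γ) not-entry) (local-root q n) ⟩
    1 ∎
    where
    open ≤-Reasoning
    not-entry : loc q n ∉ entriesOf X Γ
    not-entry m with interface-top X Γ (∈-++⁺ˡ m)
    ... | _ , ()

  exit-undefined : ∀ {a} → a ∈ exitsOf X Γ → a ∉ sources cpsJumps
  exit-undefined {a} exit source with interface-top X Γ (∈-++⁺ʳ (entriesOf X Γ) exit)
  ... | n , refl = <-irrefl refl (begin-strict
    1                                   ≤⟨ ∈⇒occ source ⟩
    occ a (sources cpsJumps)            ≤⟨ sources-bound d [] _ _ _ fits fitsC a ⟩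
    occ a (entriesOf X Γ) + 0           <⟨ +-monoʳ-< _ (∈⇒occ exit) ⟩
    occ a (entriesOf X Γ) + occ a (exitsOf X Γ) ≤⟨ interface-occ≤1 X Γ a ⟩
    1 ∎)
    where open ≤-Reasoning

  wellFormed : WellFormed erasedProgram
  wellFormed =
    occ≤1⇒Unique _ (λ a → ≤-trans (m≤m+n _ _) (interface-occ≤1 X Γ a)) ,
    occ≤1⇒Unique _ (λ a → ≤-trans (m≤n+m _ _) (interface-occ≤1 X Γ a)) ,
    subst Unique (map-∘ cpsJumps) (occ≤1⇒Unique _ sources-occ≤1) ,
    All.map⁺ (All.tabulate λ m exit → exit-undefined exit (∈-map⁺ proj₁ m))

  entries-unit : map (λ _ → unit) (entriesOf X Γ) ≡ minus X ++ plusC Γ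
  entries-unit = map-const-unit (entriesOf X Γ)
    (trans (length-++ (topXm X)) (trans (cong₂ _+_ (proj₁ fits) (proj₂ ctx-lengths)) (sym (length-++ (minus X)))))
    (All++ (minus-units X) (proj₂ (ctx-units Γ)))
    where ctx-lengths = length-ctxBlocks Γ (topCl X Γ) fitsC

  exits-unit : map (λ _ → unit) (exitsOf X Γ) ≡ plus X ++ minusC Γ
  exits-unit = map-const-unit (exitsOf X Γ)
    (trans (length-++ (topXp X)) (trans (cong₂ _+_ (proj₂ fits) (proj₁ ctx-lengths)) (sym (length-++ (plus X)))))
    (All++ (plus-units X) (proj₁ (ctx-units Γ)))
    where ctx-lengths = length-ctxBlocks Γ (topCl X Γ) fitsC

  typed : erasedProgram ∶ (minus X ++ plusC Γ) ⟶ (plus X ++ minusC Γ)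
  typed = wellFormed , (λ _ → unit) , entries-unit , exits-unit , All.map⁺ (All.tabulate λ _ → t-unit)

  root-head : hd (topXm X) ≡ top 0
  root-head = cong hd (proj₁ (top-shifted X Γ))

  -- A trace of either program is realised by a trace of the other; on top
  -- labels, where φ and ψ are the identity, this is the equality in 𝕋.
  erased⇒int : ∀ {a b} → Trace erasedProgram a b → Trace Int⟦ d ⟧ (ψ (proj₁ a) , vunit) (ψ (proj₁ b) , vunit)
  erased⇒int trace =
    path⇒trace (int-unitJumps d [] _ _ _)
      (realise-path (cps⇒int d [] _ _ _ (top 0) intJumps fits fitsC (top-shifted X Γ) (sym root-head) root-head (λ m → m))
        (subst (λ G → Path G _ _) (defEdges-erased cpsJumps) (trace⇒path (erased-unitJumps cpsJumps) trace)))

  int⇒erased : ∀ {a b} → Trace Int⟦ d ⟧ a b → Trace erasedProgram (φ (proj₁ a) , vunit) (φ (proj₁ b) , vunit)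
  int⇒erased trace =
    path⇒trace (erased-unitJumps cpsJumps)
      (subst (λ G → Path G _ _) (sym (defEdges-erased cpsJumps))
        (realise-path (int⇒cps d [] _ _ _ (top 0) cpsJumps fits fitsC (top-shifted X Γ)
                                (subst (λ z → Path cpsJumps (φ z) (top 0)) (sym root-head) ε) (λ m → m))
          (trace⇒path (int-unitJumps d [] _ _ _) trace)))

  -- Both programs have the same entry and exit labels, all of them top labels,
  -- and all values of unit type are <>.
  equal : ProgEq (minus X ++ plusC Γ) (plus X ++ minusC Γ) erasedProgram Int⟦ d ⟧
  equal i j f g h k A B v w nf ng nh nk nA nB ⊢v ⊢w
    with just-injective (trans (sym nf) ng) | just-injective (trans (sym nh) nk)
       | unit-value (All.lookup (All++ (minus-units X) (proj₂ (ctx-units Γ))) (nth-∈ (minus X ++ plusC Γ) i nA)) ⊢v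
       | unit-value (All.lookup (All++ (plus-units X) (proj₁ (ctx-units Γ))) (nth-∈ (plus X ++ minusC Γ) j nB)) ⊢w
  ... | refl | refl | refl | refl
    with interface-top X Γ (∈-++⁺ˡ (nth-∈ (entriesOf X Γ) i nf))
       | interface-top X Γ (∈-++⁺ʳ (entriesOf X Γ) (nth-∈ (exitsOf X Γ) j nh))
  ... | _ , refl | _ , refl = erased⇒int , int⇒erased

proposition6p3 : ∀ {Γ t X} (d : Γ ⊢ t ∶ X) →
  Σ Prog λ P → (CpsDefun d ≡ just P) ×
    (Erase P ∶ (minus X ++ plusC Γ) ⟶ (plus X ++ minusC Γ)) ×
    ProgEq (minus X ++ plusC Γ) (plus X ++ minusC Γ) (Erase P) Int⟦ d ⟧
proposition6p3 {Γ} {X = X} d =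
  program , cpsDefun-program ,
  subst (_∶ (minus X ++ plusC Γ) ⟶ (plus X ++ minusC Γ)) (sym erased) typed ,
  subst (λ P → ProgEq (minus X ++ plusC Γ) (plus X ++ minusC Γ) P Int⟦ d ⟧) (sym erased) equal
  where open Root d
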